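{- Let $m>4$ be a composite integer and let $d\in\{0,1,\ldots,m-1\}$. Then there is no function $f:\mathbb{N}\to\mathbb{N}$ such that for every positive integer $k$, every finite graph $G$ and every $A\subseteq V(G)$, the graph $G$ contains either $k$ pairwise vertex-disjoint $A$-paths of length congruent to $d$ modulo $m$, or a vertex set $X$ with $|X|\le f(k)$ meeting every $A$-path of length congruent to $d$ modulo $m$. That is, $A$-paths of length congruent to $d$ modulo $m$ do not have the Erdős–Pósa property.
   Context: An $A$-path is a path with at least one edge whose two endvertices lie in $A$ and none of whose interior vertices lie in $A$. The length of a path is its number of edges. -}

module Defs where

open import Data.Nat using (ℕ; zero; suc; _≤_; _<_; _%_; NonZero)
open import Data.Fin using (Fin; zero; suc; inject₁; fromℕ)
open import Data.Fin.Subset using (Subset; _∈_; _∉_; ∣_∣)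
open import Data.Sum using (_⊎_)
open import Data.Product using (Σ; ∃; _×_)
open import Relation.Nullary using (¬_)
open import Relation.Binary.PropositionalEquality using (_≡_; _≢_)
open import Function.Definitions using (Injective)

record Graph (n : ℕ) : Set₁ where
  field
    Adj     : Fin n → Fin n → Set
    sym     : ∀ {u v} → Adj u v → Adj v u
    irrefl  : ∀ {v} → ¬ Adj v v

record Path {n : ℕ} (G : Graph n) : Set where
  field
    len  : ℕ
    vert : Fin (suc len) → Fin n
    inj  : Injective _≡_ _≡_ vert
    adj  : ∀ (i : Fin len) → Graph.Adj G (vert (inject₁ i)) (vert (suc i))

open Path public

record IsAPath {n : ℕ} {G : Graph n} (A : Subset n) (P : Path G) : Set where
  field
    nonTrivial : 1 ≤ len P
    startIn    : vert P zero ∈ A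
    endIn      : vert P (fromℕ (len P)) ∈ A
    interior   : ∀ (i : Fin (suc (len P))) → i ≢ zero → i ≢ fromℕ (len P) →
                 vert P i ∉ A

ModAPath : {n : ℕ} (G : Graph n) (A : Subset n) (m d : ℕ) .{{_ : NonZero m}} →
           Path G → Set
ModAPath G A m d P = IsAPath A P × (len P % m ≡ d % m)

Disjoint : {n : ℕ} {G : Graph n} → Path G → Path G → Set
Disjoint P Q = ∀ i j → vert P i ≢ vert Q j

Meets : {n : ℕ} {G : Graph n} → Subset n → Path G → Set
Meets X P = ∃ λ i → vert P i ∈ X

EPFunction : (m d : ℕ) .{{_ : NonZero m}} → (ℕ → ℕ) → Set₁
EPFunction m d f =
  ∀ (k : ℕ) → 1 ≤ k → ∀ (n : ℕ) (G : Graph n) (A : Subset n) →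
    (Σ (Fin k → Path G) λ Ps →
        (∀ i → ModAPath G A m d (Ps i)) ×
        (∀ i j → i ≢ j → Disjoint (Ps i) (Ps j)))
    ⊎
    (Σ (Subset n) λ X → ∣ X ∣ ≤ f k ×
        (∀ (P : Path G) → ModAPath G A m d P → Meets X P))

module Submission where

-- The graph is a grid: R rows y = m i from a left terminal (0, m i) to a
-- right terminal (W, m i), and columns x = a + m j of full height; on the top
-- row each gap between consecutive columns is bridged by one long edge of
-- span h0 + 1, for a proper divisor 3 ≤ h0 of m, followed by unit edges.
-- Since rows and columns are spaced by m, the geometric length of a path is
-- determined mod m by its two ends, while its number of edges differs from the
-- geometric length by h0 per long edge used.  For suitable offsets a and b,
-- every A-path of length ≡ d mod m therefore joins the two sides through a
-- long edge, reaching the top row, and two disjoint such paths cannot exist: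
-- the one starting lower is cut off from the top by the other (a parity of
-- crossings argument).  But any N vertices miss some row and some pair of
-- adjacent columns, and the detour along that row over the top between these
-- columns is an A-path of length ≡ d mod m avoiding them.

open import Defs
open import Data.Nat using (ℕ; _<_; NonZero)
open import Data.Nat.Primality using (Composite)
open import Data.Product using (Σ)
open import Relation.Nullary using (¬_)
open import Data.Nat using (_≤_)

module Crossing where

  open import Data.Nat hiding (parity)
  open import Data.Nat.Properties
  open import Data.Bool using (Bool; true; false; _∧_; _∨_; _xor_; not; T)
  open import Data.Bool.Properties
    using (∨-identityʳ; ∨-comm; ∧-zeroʳ; ∧-identityʳ; ∧-comm; xor-assoc; xor-comm; xor-same; xor-identityʳ; ∧-distribʳ-xor)
  open import Data.Unit using (tt)
  open import Data.Product using (_×_; _,_; proj₁; proj₂)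
  open import Data.Sum using (_⊎_; inj₁; inj₂)
  open import Data.Empty using (⊥-elim)
  open import Relation.Nullary using (¬_; yes; no; does)
  open import Relation.Nullary.Decidable using (dec-true; dec-false)
  open import Relation.Binary.PropositionalEquality
  open import Relation.Binary.Definitions using (tri<; tri≈; tri>)

  Point : Set
  Point = ℕ × ℕ

  -- Opaque, so that the case analyses below can rewrite with these
  -- equations instead of fighting the reduction of _≟_ and _<?_.
  opaque
    eqᵇ : ℕ → ℕ → Bool
    eqᵇ a b = does (a ≟ b)

    ltᵇ : ℕ → ℕ → Bool
    ltᵇ a b = does (a <? b)

    leᵇ : ℕ → ℕ → Bool
    leᵇ a b = does (a ≤? b)

    eqᵇ-true : ∀ {a b} → a ≡ b → eqᵇ a b ≡ true
    eqᵇ-true {a} {b} = dec-true (a ≟ b)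

    eqᵇ-false : ∀ {a b} → a ≢ b → eqᵇ a b ≡ false
    eqᵇ-false {a} {b} = dec-false (a ≟ b)

    ltᵇ-true : ∀ {a b} → a < b → ltᵇ a b ≡ true
    ltᵇ-true {a} {b} = dec-true (a <? b)

    ltᵇ-false : ∀ {a b} → ¬ a < b → ltᵇ a b ≡ false
    ltᵇ-false {a} {b} = dec-false (a <? b)

    leᵇ-true : ∀ {a b} → a ≤ b → leᵇ a b ≡ true
    leᵇ-true {a} {b} = dec-true (a ≤? b)

    leᵇ-false : ∀ {a b} → ¬ a ≤ b → leᵇ a b ≡ false
    leᵇ-false {a} {b} = dec-false (a ≤? b)

    leᵇ-sound : ∀ {a b} → leᵇ a b ≡ true → a ≤ b
    leᵇ-sound {a} {b} e = ≤ᵇ⇒≤ a b (subst T (sym e) tt)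

    ltᵇ-sound : ∀ {a b} → ltᵇ a b ≡ true → a < b
    ltᵇ-sound {a} {b} e = <ᵇ⇒< a b (subst T (sym e) tt)

  eqᵇ-sym : ∀ a b → eqᵇ a b ≡ eqᵇ b a
  eqᵇ-sym a b with a ≟ b
  ... | yes refl = refl
  ... | no a≢b rewrite eqᵇ-false a≢b | eqᵇ-false (≢-sym a≢b) = refl

  ltᵇ-sucˡ : ∀ y h → h ≢ suc y → ltᵇ y h ≡ ltᵇ (suc y) h
  ltᵇ-sucˡ y h h≢ with <-cmp y h
  ... | tri< y<h _ _ rewrite ltᵇ-true y<h | ltᵇ-true (≤∧≢⇒< y<h (≢-sym h≢)) = refl
  ... | tri≈ _ refl _ rewrite ltᵇ-false (<-irrefl {y} refl) | ltᵇ-false (<-asym (n<1+n y)) = refl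
  ... | tri> _ _ h<y rewrite ltᵇ-false (<-asym h<y) | ltᵇ-false (<-asym (<-trans h<y (n<1+n y))) = refl

  ltᵇ-sucʳ : ∀ y h → h ≢ y → ltᵇ y h ≡ ltᵇ y (suc h)
  ltᵇ-sucʳ y h h≢ with <-cmp y h
  ... | tri< y<h _ _ rewrite ltᵇ-true y<h | ltᵇ-true (<-trans y<h (n<1+n h)) = refl
  ... | tri≈ _ refl _ = ⊥-elim (h≢ refl)
  ... | tri> _ _ h<y rewrite ltᵇ-false (<-asym h<y) | ltᵇ-false (λ p → <-irrefl refl (≤-trans p h<y)) = refl

  ∨-true : ∀ p q → p ∨ q ≡ true → (p ≡ true) ⊎ (q ≡ true)
  ∨-true true q e = inj₁ refl
  ∨-true false q e = inj₂ e

  ∧-true : ∀ p q → p ∧ q ≡ true → (p ≡ true) × (q ≡ true)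
  ∧-true true true e = refl , refl

  xor-interchange : ∀ a b c d → (a xor b) xor (c xor d) ≡ (a xor c) xor (b xor d)
  xor-interchange false false c d = refl
  xor-interchange false true false d = refl
  xor-interchange false true true false = refl
  xor-interchange false true true true = refl
  xor-interchange true false false d = refl
  xor-interchange true false true false = refl
  xor-interchange true false true true = refl
  xor-interchange true true false false = refl
  xor-interchange true true false true = refl
  xor-interchange true true true false = refl
  xor-interchange true true true true = refl

  xor≡false⇒≡ : ∀ a b → a xor b ≡ false → a ≡ b
  xor≡false⇒≡ false false e = refl
  xor≡false⇒≡ true true e = refl

  ∧-split : ∀ a b c → a ∧ (b ∧ c) ≡ (a ∧ c) xor (a ∧ (not b ∧ c))
  ∧-split false b c = refl
  ∧-split true false false = refl
  ∧-split true false true = refl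
  ∧-split true true false = refl
  ∧-split true true true = refl

  parity : ℕ → (ℕ → Bool) → Bool
  parity zero f = false
  parity (suc k) f = parity k f xor f k

  parity-cong : ∀ L (f g : ℕ → Bool) → (∀ k → k < L → f k ≡ g k) → parity L f ≡ parity L g
  parity-cong zero f g e = refl
  parity-cong (suc L) f g e =
    cong₂ _xor_ (parity-cong L f g (λ k k<L → e k (m<n⇒m<1+n k<L))) (e L ≤-refl)

  parity-false : ∀ L (f : ℕ → Bool) → (∀ k → k < L → f k ≡ false) → parity L f ≡ false
  parity-false L f e = trans (parity-cong L f (λ _ → false) e) (zeros L)
    where
    zeros : ∀ L → parity L (λ _ → false) ≡ false
    zeros zero = refl
    zeros (suc L) = cong (_xor false) (zeros L)

  parity-xor : ∀ L (f g : ℕ → Bool) → parity L (λ k → f k xor g k) ≡ parity L f xor parity L g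
  parity-xor zero f g = refl
  parity-xor (suc L) f g =
    trans (cong (_xor (f L xor g L)) (parity-xor L f g)) (xor-interchange (parity L f) (parity L g) (f L) (g L))

  parity-telescope : ∀ L (h : ℕ → Bool) → parity L (λ k → h k xor h (suc k)) ≡ h 0 xor h L
  parity-telescope zero h = sym (xor-same (h 0))
  parity-telescope (suc L) h = begin
      parity L (λ k → h k xor h (suc k)) xor (h L xor h (suc L))
    ≡⟨ cong (_xor (h L xor h (suc L))) (parity-telescope L h) ⟩
      (h 0 xor h L) xor (h L xor h (suc L))
    ≡⟨ xor-assoc (h 0) (h L) _ ⟩
      h 0 xor (h L xor (h L xor h (suc L)))
    ≡⟨ cong (h 0 xor_) (sym (xor-assoc (h L) (h L) _)) ⟩
      h 0 xor ((h L xor h L) xor h (suc L))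
    ≡⟨ cong (λ z → h 0 xor (z xor h (suc L))) (xor-same (h L)) ⟩
      h 0 xor h (suc L) ∎
    where open ≡-Reasoning

  -- The horizontal segment from a to b straddles the vertical line x + ½.
  straddles : ℕ → ℕ → ℕ → Bool
  straddles x a b = (leᵇ a x ∧ ltᵇ x b) ∨ (leᵇ b x ∧ ltᵇ x a)

  straddles-< : ∀ x a b → a < b → straddles x a b ≡ (leᵇ a x ∧ ltᵇ x b)
  straddles-< x a b a<b with x <? a
  ... | yes x<a rewrite leᵇ-false {b} {x} (λ b≤x → <-asym a<b (≤-<-trans b≤x x<a)) = ∨-identityʳ _
  ... | no x≮a rewrite ltᵇ-false {x} {a} x≮a | ∧-zeroʳ (leᵇ b x) = ∨-identityʳ _

  straddles-sym : ∀ x a b → straddles x a b ≡ straddles x b a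
  straddles-sym x a b = ∨-comm (leᵇ a x ∧ ltᵇ x b) (leᵇ b x ∧ ltᵇ x a)

  straddles-step-< : ∀ x a b → a < b →
    straddles x a b xor straddles (suc x) a b ≡ eqᵇ a (suc x) xor eqᵇ b (suc x)
  straddles-step-< x a b a<b rewrite straddles-< x a b a<b | straddles-< (suc x) a b a<b with <-cmp (suc x) a
  ... | tri< sx<a _ _
    rewrite leᵇ-false {a} {x} (λ a≤x → <-irrefl refl (≤-trans sx<a (≤-trans a≤x (n≤1+n x))))
          | leᵇ-false {a} {suc x} (<⇒≱ sx<a)
          | eqᵇ-false {a} {suc x} (λ e → <-irrefl (sym e) sx<a)
          | eqᵇ-false {b} {suc x} (λ e → <-irrefl (sym e) (<-trans sx<a a<b)) = refl
  ... | tri≈ _ refl _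
    rewrite leᵇ-false {suc x} {x} (<-irrefl refl)
          | leᵇ-true {suc x} {suc x} ≤-refl
          | ltᵇ-true {suc x} {b} a<b
          | eqᵇ-true {suc x} {suc x} refl
          | eqᵇ-false {b} {suc x} (λ e → <-irrefl (sym e) a<b) = refl
  ... | tri> _ _ a<sx with <-cmp (suc x) b
  ...   | tri< sx<b _ _
    rewrite leᵇ-true {a} {x} (≤-pred a<sx)
          | leᵇ-true {a} {suc x} (<⇒≤ a<sx)
          | ltᵇ-true {x} {b} (<-trans (n<1+n x) sx<b)
          | ltᵇ-true {suc x} {b} sx<b
          | eqᵇ-false {a} {suc x} (λ e → <-irrefl e a<sx)
          | eqᵇ-false {b} {suc x} (λ e → <-irrefl (sym e) sx<b) = refl
  ...   | tri≈ _ refl _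
    rewrite leᵇ-true {a} {x} (≤-pred a<sx)
          | leᵇ-true {a} {suc x} (<⇒≤ a<sx)
          | ltᵇ-true {x} {suc x} (n<1+n x)
          | ltᵇ-false {suc x} {suc x} (<-irrefl refl)
          | eqᵇ-false {a} {suc x} (λ e → <-irrefl e a<sx)
          | eqᵇ-true {suc x} {suc x} refl = refl
  ...   | tri> _ _ b<sx
    rewrite leᵇ-true {a} {x} (≤-pred a<sx)
          | leᵇ-true {a} {suc x} (<⇒≤ a<sx)
          | ltᵇ-false {x} {b} (λ p → <-irrefl refl (≤-trans b<sx p))
          | ltᵇ-false {suc x} {b} (λ p → <-asym p b<sx)
          | eqᵇ-false {a} {suc x} (λ e → <-irrefl e a<sx)
          | eqᵇ-false {b} {suc x} (λ e → <-irrefl e b<sx) = refl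

  straddles-step : ∀ x a b → a ≢ b →
    straddles x a b xor straddles (suc x) a b ≡ eqᵇ a (suc x) xor eqᵇ b (suc x)
  straddles-step x a b a≢b with <-cmp a b
  ... | tri< a<b _ _ = straddles-step-< x a b a<b
  ... | tri≈ _ e _ = ⊥-elim (a≢b e)
  ... | tri> _ _ b<a rewrite straddles-sym x a b | straddles-sym (suc x) a b
    = trans (straddles-step-< x b a b<a) (xor-comm (eqᵇ b (suc x)) (eqᵇ a (suc x)))

  straddles-zero-< : ∀ a b → a < b → straddles 0 a b ≡ eqᵇ a 0 xor eqᵇ b 0
  straddles-zero-< zero b a<b
    rewrite straddles-< 0 0 b a<b | leᵇ-true {0} {0} z≤n | ltᵇ-true {0} {b} a<b
          | eqᵇ-true {0} {0} refl | eqᵇ-false {b} {0} (λ e → <-irrefl (sym e) a<b) = refl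
  straddles-zero-< (suc a) b a<b
    rewrite straddles-< 0 (suc a) b a<b | leᵇ-false {suc a} {0} (λ ())
          | eqᵇ-false {suc a} {0} (λ ()) | eqᵇ-false {b} {0} (λ e → <-irrefl (sym e) (≤-trans (s≤s z≤n) a<b)) = refl

  straddles-zero : ∀ a b → a ≢ b → straddles 0 a b ≡ eqᵇ a 0 xor eqᵇ b 0
  straddles-zero a b a≢b with <-cmp a b
  ... | tri< a<b _ _ = straddles-zero-< a b a<b
  ... | tri≈ _ e _ = ⊥-elim (a≢b e)
  ... | tri> _ _ b<a rewrite straddles-sym 0 a b
    = trans (straddles-zero-< b a b<a) (xor-comm (eqᵇ b 0) (eqᵇ a 0))

  data Between (z a b : ℕ) : Set where
    between< : a < z → z < b → Between z a b
    between> : b < z → z < a → Between z a b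

  straddles-cases : ∀ x a b → straddles x a b ≡ true → (x ≡ a) ⊎ ((x ≡ b) ⊎ Between x a b)
  straddles-cases x a b e with ∨-true _ _ e
  ... | inj₁ e1 with ∧-true _ _ e1
  ...   | e2 , e3 with m≤n⇒m<n∨m≡n (leᵇ-sound e2)
  ...     | inj₁ a<x = inj₂ (inj₂ (between< a<x (ltᵇ-sound e3)))
  ...     | inj₂ refl = inj₁ refl
  straddles-cases x a b e | inj₂ e1 with ∧-true _ _ e1
  ...   | e2 , e3 with m≤n⇒m<n∨m≡n (leᵇ-sound e2)
  ...     | inj₁ b<x = inj₂ (inj₂ (between> b<x (ltᵇ-sound e3)))
  ...     | inj₂ refl = inj₂ (inj₁ refl)

  module PlaneGraph (Edge : Point → Point → Set) (Edge-sym : ∀ {p q} → Edge p q → Edge q p) where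

    Isolated : Point → Set
    Isolated r = ∀ s → ¬ Edge r s

    data Shape (p q : Point) : Set where
      up         : proj₁ p ≡ proj₁ q → proj₂ q ≡ suc (proj₂ p) → Shape p q
      down       : proj₁ p ≡ proj₁ q → proj₂ p ≡ suc (proj₂ q) → Shape p q
      horizontal : proj₂ p ≡ proj₂ q → proj₁ p ≢ proj₁ q →
                   (∀ z → Between z (proj₁ p) (proj₁ q) → Isolated (z , proj₂ p)) → Shape p q

    -- The side of the cell (x + ½, y + ½) is the
    -- parity of the number of horizontal walk edges above it straddling
    -- x + ½; the term closing accounts for a horizontal ray leaving the
    -- endpoint to the right, which makes the walk separate the plane.
    module Side (shape : ∀ {p q} → Edge p q → Shape p q) (W Ht L : ℕ) (pt : ℕ → Point)
      (pt-step : ∀ k → k < L → Edge (pt k) (pt (suc k))) (1≤L : 1 ≤ L)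
      (pt-height : ∀ k → k ≤ L → proj₂ (pt k) ≤ Ht)
      (pt-start : proj₁ (pt 0) ≡ 0) (pt-end : proj₁ (pt L) ≡ W) (1≤W : 1 ≤ W) where

      OffWalk : Point → Set
      OffWalk r = ∀ j → j ≤ L → pt j ≢ r

      crossesAbove : ℕ → ℕ → Point → Point → Bool
      crossesAbove x y p q = eqᵇ (proj₂ p) (proj₂ q) ∧ (ltᵇ y (proj₂ p) ∧ straddles x (proj₁ p) (proj₁ q))

      closing : ℕ → ℕ → Bool
      closing x y = eqᵇ x W ∧ ltᵇ y (proj₂ (pt L))

      crossings : ℕ → ℕ → ℕ → Bool
      crossings x y k = crossesAbove x y (pt k) (pt (suc k))

      side : ℕ → ℕ → Bool
      side x y = parity L (crossings x y) xor closing x y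

      walk-not-isolated : ∀ j → j ≤ L → ¬ Isolated (pt j)
      walk-not-isolated j j≤L iso with m≤n⇒m<n∨m≡n j≤L
      ... | inj₁ j<L = iso _ (pt-step j j<L)
      ... | inj₂ refl = iso _ (Edge-sym (subst (λ z → Edge (pt (L ∸ 1)) (pt z)) L-1+1
                          (pt-step (L ∸ 1) (subst (L ∸ 1 <_) L-1+1 ≤-refl))))
        where
        L-1+1 : suc (L ∸ 1) ≡ L
        L-1+1 = m+[n∸m]≡n 1≤L

      onColumn : ℕ → ℕ → Point → Bool
      onColumn x y v = eqᵇ (proj₁ v) (suc x) ∧ ltᵇ y (proj₂ v)

      crossesAbove-stepʳ : ∀ x y p q → Edge p q → p ≢ (suc x , y) → q ≢ (suc x , y) →
        crossesAbove x y p q xor crossesAbove (suc x) y p q ≡ onColumn x y p xor onColumn x y q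
      crossesAbove-stepʳ x y (a , h) (b , h') e np nq with shape e
      ... | up refl refl rewrite eqᵇ-false {h} {suc h} (λ ()) with a ≟ suc x
      ...   | no a≢ rewrite eqᵇ-false a≢ = refl
      ...   | yes refl rewrite eqᵇ-true {suc x} refl with h ≟ y
      ...     | yes refl = ⊥-elim (np refl)
      ...     | no h≢y rewrite ltᵇ-sucʳ y h h≢y = sym (xor-same (ltᵇ y (suc h)))
      crossesAbove-stepʳ x y (a , h) (b , h') e np nq | down refl refl
        rewrite eqᵇ-false {suc h'} {h'} (λ ()) with a ≟ suc x
      ...   | no a≢ rewrite eqᵇ-false a≢ = refl
      ...   | yes refl rewrite eqᵇ-true {suc x} refl with h' ≟ y
      ...     | yes refl = ⊥-elim (nq refl)
      ...     | no h≢y rewrite ltᵇ-sucʳ y h' h≢y = sym (xor-same (ltᵇ y (suc h')))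
      crossesAbove-stepʳ x y (a , h) (b , h') e np nq | horizontal refl a≢b _
        rewrite eqᵇ-true {h} refl with y <? h
      ... | no y≮h rewrite ltᵇ-false y≮h | ∧-zeroʳ (eqᵇ a (suc x)) | ∧-zeroʳ (eqᵇ b (suc x)) = refl
      ... | yes y<h rewrite ltᵇ-true y<h | ∧-identityʳ (eqᵇ a (suc x)) | ∧-identityʳ (eqᵇ b (suc x))
        = straddles-step x a b a≢b

      side-stepʳ : ∀ x y → x < W → OffWalk (suc x , y) → side x y ≡ side (suc x) y
      side-stepʳ x y x<W off = xor≡false⇒≡ _ _ (begin
          side x y xor side (suc x) y
        ≡⟨ xor-interchange (parity L (crossings x y)) _ (parity L (crossings (suc x) y)) _ ⟩
          (parity L (crossings x y) xor parity L (crossings (suc x) y)) xor closed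
        ≡⟨ cong (_xor closed) (sym (parity-xor L (crossings x y) (crossings (suc x) y))) ⟩
          parity L (λ k → crossings x y k xor crossings (suc x) y k) xor closed
        ≡⟨ cong (_xor closed) (parity-cong L _ _ (λ k k<L →
              crossesAbove-stepʳ x y (pt k) (pt (suc k)) (pt-step k k<L) (off k (<⇒≤ k<L)) (off (suc k) k<L))) ⟩
          parity L (λ k → onColumn x y (pt k) xor onColumn x y (pt (suc k))) xor closed
        ≡⟨ cong (_xor closed) (parity-telescope L (λ k → onColumn x y (pt k))) ⟩
          (onColumn x y (pt 0) xor onColumn x y (pt L)) xor closed
        ≡⟨ ends ⟩
          false ∎)
        where
        open ≡-Reasoning
        closed : Bool
        closed = closing x y xor closing (suc x) y
        ends : (onColumn x y (pt 0) xor onColumn x y (pt L)) xor closed ≡ false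
        ends rewrite pt-start | pt-end | eqᵇ-false {0} {suc x} (λ ()) | eqᵇ-false {x} {W} (λ e → <-irrefl e x<W)
          | eqᵇ-sym W (suc x) = xor-same (eqᵇ (suc x) W ∧ ltᵇ y (proj₂ (pt L)))

      crossesAbove-stepᵘ : ∀ x y p q → Edge p q → p ≢ (x , suc y) → q ≢ (x , suc y) → ¬ Isolated (x , suc y) →
        crossesAbove x y p q xor crossesAbove x (suc y) p q ≡ false
      crossesAbove-stepᵘ x y (a , h) (b , h') e np nq ni with shape e
      ... | up refl refl rewrite eqᵇ-false {h} {suc h} (λ ()) = refl
      ... | down refl refl rewrite eqᵇ-false {suc h'} {h'} (λ ()) = refl
      ... | horizontal refl a≢b iso rewrite eqᵇ-true {h} refl with straddles x a b in ecv
      ... | false rewrite ∧-zeroʳ (ltᵇ y h) | ∧-zeroʳ (ltᵇ (suc y) h) = refl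
      ... | true rewrite ∧-identityʳ (ltᵇ y h) | ∧-identityʳ (ltᵇ (suc y) h) with h ≟ suc y
      ...   | no h≢ rewrite ltᵇ-sucˡ y h h≢ = xor-same (ltᵇ (suc y) h)
      ...   | yes refl with straddles-cases x a b ecv
      ...     | inj₁ refl = ⊥-elim (np refl)
      ...     | inj₂ (inj₁ refl) = ⊥-elim (nq refl)
      ...     | inj₂ (inj₂ bt) = ⊥-elim (ni (iso x bt))

      side-stepᵘ : ∀ x y → OffWalk (x , suc y) → ¬ Isolated (x , suc y) → side x y ≡ side x (suc y)
      side-stepᵘ x y off ni = xor≡false⇒≡ _ _ (begin
          side x y xor side x (suc y)
        ≡⟨ xor-interchange (parity L (crossings x y)) _ (parity L (crossings x (suc y))) _ ⟩
          (parity L (crossings x y) xor parity L (crossings x (suc y))) xor closed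
        ≡⟨ cong (_xor closed) (sym (parity-xor L (crossings x y) (crossings x (suc y)))) ⟩
          parity L (λ k → crossings x y k xor crossings x (suc y) k) xor closed
        ≡⟨ cong (_xor closed) (parity-false L _ (λ k k<L →
              crossesAbove-stepᵘ x y (pt k) (pt (suc k)) (pt-step k k<L) (off k (<⇒≤ k<L)) (off (suc k) k<L) ni)) ⟩
          closed
        ≡⟨ closed≡false ⟩
          false ∎)
        where
        open ≡-Reasoning
        closed : Bool
        closed = closing x y xor closing x (suc y)
        closed≡false : closed ≡ false
        closed≡false with x ≟ W
        ... | no x≢W rewrite eqᵇ-false x≢W = refl
        ... | yes refl rewrite eqᵇ-true {x} refl with proj₂ (pt L) ≟ suc y
        ...   | no h≢ rewrite ltᵇ-sucˡ y (proj₂ (pt L)) h≢ = xor-same (ltᵇ (suc y) (proj₂ (pt L)))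
        ...   | yes e = ⊥-elim (off L ≤-refl (cong₂ _,_ pt-end e))

      crossings-top : ∀ x k → k < L → crossings x Ht k ≡ false
      crossings-top x k k<L
        rewrite ltᵇ-false {Ht} {proj₂ (pt k)} (λ p → <-irrefl refl (≤-trans p (pt-height k (<⇒≤ k<L))))
        | ∧-zeroʳ (eqᵇ (proj₂ (pt k)) (proj₂ (pt (suc k)))) = refl

      side-top : ∀ x → side x Ht ≡ false
      side-top x rewrite parity-false L (crossings x Ht) (crossings-top x)
        | ltᵇ-false {Ht} {proj₂ (pt L)} (λ p → <-irrefl refl (≤-trans p (pt-height L ≤-refl)))
        | ∧-zeroʳ (eqᵇ x W) = refl

      -- On the left border, split crossings into all straddling edges
      -- (which telescope to the two endpoints) and those below y.
      straddlesZero : Point → Point → Bool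
      straddlesZero p q = eqᵇ (proj₂ p) (proj₂ q) ∧ straddles 0 (proj₁ p) (proj₁ q)
      straddlesZeroBelow : ℕ → Point → Point → Bool
      straddlesZeroBelow y p q = eqᵇ (proj₂ p) (proj₂ q) ∧ (not (ltᵇ y (proj₂ p)) ∧ straddles 0 (proj₁ p) (proj₁ q))

      onBorder : Point → Bool
      onBorder v = eqᵇ (proj₁ v) 0

      onBorderBelow : ℕ → Point → Bool
      onBorderBelow y v = eqᵇ (proj₁ v) 0 ∧ not (ltᵇ y (proj₂ v))

      straddlesZero-step : ∀ p q → Edge p q → straddlesZero p q ≡ onBorder p xor onBorder q
      straddlesZero-step (a , h) (b , h') e with shape e
      ... | up refl refl rewrite eqᵇ-false {h} {suc h} (λ ()) = sym (xor-same (eqᵇ a 0))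
      ... | down refl refl rewrite eqᵇ-false {suc h'} {h'} (λ ()) = sym (xor-same (eqᵇ a 0))
      ... | horizontal refl a≢b _ rewrite eqᵇ-true {h} refl = straddles-zero a b a≢b

      straddlesZeroBelow-step : ∀ y p q → Edge p q → p ≢ (0 , y) → q ≢ (0 , y) →
        straddlesZeroBelow y p q ≡ onBorderBelow y p xor onBorderBelow y q
      straddlesZeroBelow-step y (a , h) (b , h') e np nq with shape e
      ... | up refl refl rewrite eqᵇ-false {h} {suc h} (λ ()) with a ≟ 0
      ...   | no a≢ rewrite eqᵇ-false a≢ = refl
      ...   | yes refl rewrite eqᵇ-true {0} refl with h ≟ y
      ...     | yes refl = ⊥-elim (np refl)
      ...     | no h≢y rewrite ltᵇ-sucʳ y h h≢y = sym (xor-same (not (ltᵇ y (suc h))))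
      straddlesZeroBelow-step y (a , h) (b , h') e np nq | down refl refl
        rewrite eqᵇ-false {suc h'} {h'} (λ ()) with a ≟ 0
      ...   | no a≢ rewrite eqᵇ-false a≢ = refl
      ...   | yes refl rewrite eqᵇ-true {0} refl with h' ≟ y
      ...     | yes refl = ⊥-elim (nq refl)
      ...     | no h≢y rewrite ltᵇ-sucʳ y h' h≢y = sym (xor-same (not (ltᵇ y (suc h'))))
      straddlesZeroBelow-step y (a , h) (b , h') e np nq | horizontal refl a≢b _
        rewrite eqᵇ-true {h} refl | sym (∧-distribʳ-xor (not (ltᵇ y h)) (eqᵇ a 0) (eqᵇ b 0)) | straddles-zero a b a≢b
        = ∧-comm (not (ltᵇ y h)) (eqᵇ a 0 xor eqᵇ b 0)

      side-left : ∀ y → y < proj₂ (pt 0) → OffWalk (0 , y) → side 0 y ≡ true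
      side-left y y<y₀ off = begin
          parity L (crossings 0 y) xor closing 0 y
        ≡⟨ cong (_xor closing 0 y) (parity-cong L _ _ (λ k _ → ∧-split (eqᵇ (proj₂ (pt k)) (proj₂ (pt (suc k))))
              (ltᵇ y (proj₂ (pt k))) (straddles 0 (proj₁ (pt k)) (proj₁ (pt (suc k)))))) ⟩
          parity L (λ k → all k xor below k) xor closing 0 y
        ≡⟨ cong (_xor closing 0 y) (parity-xor L all below) ⟩
          (parity L all xor parity L below) xor closing 0 y
        ≡⟨ cong₂ (λ u v → (u xor v) xor closing 0 y)
             (trans (parity-cong L _ _ (λ k k<L → straddlesZero-step (pt k) (pt (suc k)) (pt-step k k<L)))
                    (parity-telescope L (λ k → onBorder (pt k))))
             (trans (parity-cong L _ _ (λ k k<L → straddlesZeroBelow-step y (pt k) (pt (suc k)) (pt-step k k<L)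
                                                     (off k (<⇒≤ k<L)) (off (suc k) k<L)))
                    (parity-telescope L (λ k → onBorderBelow y (pt k)))) ⟩
          ((onBorder (pt 0) xor onBorder (pt L)) xor (onBorderBelow y (pt 0) xor onBorderBelow y (pt L))) xor closing 0 y
        ≡⟨ ends ⟩
          true ∎
        where
        open ≡-Reasoning
        all below : ℕ → Bool
        all k = straddlesZero (pt k) (pt (suc k))
        below k = straddlesZeroBelow y (pt k) (pt (suc k))
        ends : ((onBorder (pt 0) xor onBorder (pt L)) xor (onBorderBelow y (pt 0) xor onBorderBelow y (pt L)))
               xor closing 0 y ≡ true
        ends rewrite pt-start | pt-end | eqᵇ-true {0} refl | eqᵇ-false {W} {0} (λ e → <-irrefl (sym e) 1≤W)
          | eqᵇ-false {0} {W} (λ e → <-irrefl e 1≤W) | ltᵇ-true y<y₀ = refl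

    -- A second walk qt, inside the strip 0 ≤ x ≤ W and disjoint from pt,
    -- that starts on the left border below pt cannot reach the top row:
    -- the side is constant along it, true at its start and false at height Ht.
    module Separation (shape : ∀ {p q} → Edge p q → Shape p q) (W Ht L : ℕ) (pt : ℕ → Point)
      (pt-step : ∀ k → k < L → Edge (pt k) (pt (suc k))) (1≤L : 1 ≤ L)
      (pt-height : ∀ k → k ≤ L → proj₂ (pt k) ≤ Ht)
      (pt-start : proj₁ (pt 0) ≡ 0) (pt-end : proj₁ (pt L) ≡ W) (1≤W : 1 ≤ W)
      (M : ℕ) (qt : ℕ → Point) (qt-step : ∀ k → k < M → Edge (qt k) (qt (suc k)))
      (qt-width : ∀ k → k ≤ M → proj₁ (qt k) ≤ W)
      (disjoint : ∀ k j → k ≤ M → j ≤ L → pt j ≢ qt k) where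

      open Side shape W Ht L pt pt-step 1≤L pt-height pt-start pt-end 1≤W

      sideAt : Point → Bool
      sideAt r = side (proj₁ r) (proj₂ r)

      side-along-row : ∀ d a h → a + d ≤ W → (∀ z → a < z → z ≤ a + d → OffWalk (z , h)) →
        side a h ≡ side (a + d) h
      side-along-row zero a h _ _ rewrite +-identityʳ a = refl
      side-along-row (suc d) a h le off = trans
        (side-along-row d a h (≤-trans (+-monoʳ-≤ a (n≤1+n d)) le)
          (λ z a<z z≤ → off z a<z (≤-trans z≤ (+-monoʳ-≤ a (n≤1+n d)))))
        (subst (λ w → side (a + d) h ≡ side w h) (sym (+-suc a d))
          (side-stepʳ (a + d) h (subst (_≤ W) (+-suc a d) le) (subst (λ w → OffWalk (w , h)) (+-suc a d)
             (off (a + suc d) (subst (a <_) (sym (+-suc a d)) (s≤s (m≤m+n a d))) ≤-refl))))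

      side-across-edge : ∀ {a b h} → a < b → b ≤ W → (∀ z → Between z a b → Isolated (z , h)) →
        OffWalk (b , h) → side a h ≡ side b h
      side-across-edge {a} {b} {h} a<b b≤W iso off-b =
        subst (λ w → side a h ≡ side w h) (m+[n∸m]≡n (<⇒≤ a<b))
          (side-along-row (b ∸ a) a h (subst (_≤ W) (sym (m+[n∸m]≡n (<⇒≤ a<b))) b≤W) off)
        where
        off : ∀ z → a < z → z ≤ a + (b ∸ a) → OffWalk (z , h)
        off z a<z z≤ j j≤L e with m≤n⇒m<n∨m≡n (subst (z ≤_) (m+[n∸m]≡n (<⇒≤ a<b)) z≤)
        ... | inj₁ z<b = walk-not-isolated j j≤L (subst Isolated (sym e) (iso z (between< a<z z<b)))
        ... | inj₂ refl = off-b j j≤L e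

      side-step : ∀ k → k < M → sideAt (qt k) ≡ sideAt (qt (suc k))
      side-step k k<M with qt k in e₁ | qt (suc k) in e₂ | qt-step k k<M
      ... | (a , h) | (b , h') | st with shape st
      ...   | up refl refl = side-stepᵘ a h (λ j j≤L e → disjoint (suc k) j k<M j≤L (trans e (sym e₂)))
                               (λ iso → iso _ (Edge-sym st))
      ...   | down refl refl = sym (side-stepᵘ a h' (λ j j≤L e → disjoint k j (<⇒≤ k<M) j≤L (trans e (sym e₁)))
                                 (λ iso → iso _ st))
      ...   | horizontal refl a≢b iso with <-cmp a b
      ...     | tri≈ _ e _ = ⊥-elim (a≢b e)
      ...     | tri< a<b _ _ = side-across-edge a<b (subst (λ r → proj₁ r ≤ W) e₂ (qt-width (suc k) k<M)) iso
                                 (λ j j≤L e → disjoint (suc k) j k<M j≤L (trans e (sym e₂)))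
      ...     | tri> _ _ b<a = sym (side-across-edge b<a (subst (λ r → proj₁ r ≤ W) e₁ (qt-width k (<⇒≤ k<M)))
                                 (λ z bt → iso z (flip bt)) (λ j j≤L e → disjoint k j (<⇒≤ k<M) j≤L (trans e (sym e₁))))
        where
        flip : ∀ {z} → Between z b a → Between z a b
        flip (between< p q) = between> p q
        flip (between> p q) = between< p q

      side-const : ∀ k → k ≤ M → sideAt (qt k) ≡ sideAt (qt 0)
      side-const zero _ = refl
      side-const (suc k) sk≤M = trans (sym (side-step k sk≤M)) (side-const k (<⇒≤ sk≤M))

      cannot-reach-top : proj₁ (qt 0) ≡ 0 → proj₂ (qt 0) < proj₂ (pt 0) →
                         ∀ t → t ≤ M → proj₂ (qt t) ≢ Ht
      cannot-reach-top q₀-left q₀-below t t≤M qt-top = false≢true (trans (sym at-top) (trans (side-const t t≤M) at-start))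
        where
        false≢true : false ≢ true
        false≢true ()
        at-start : sideAt (qt 0) ≡ true
        at-start with qt 0 in e₀
        ... | (x , y) rewrite q₀-left = side-left y q₀-below (λ j j≤L e → disjoint 0 j z≤n j≤L (trans e (sym e₀)))
        at-top : sideAt (qt t) ≡ false
        at-top with qt t in eₜ
        ... | (x , y) rewrite qt-top = side-top x

module Congruence where

  open import Data.Nat as ℕ using (ℕ; zero; suc)
  open import Data.Nat.DivMod using (m≡m%n+[m/n]*n; [m+kn]%n≡m%n)
  open import Data.Integer using (ℤ; +_; -[1+_]; _+_; _-_; _*_; -_)
  import Data.Nat.Properties as ℕₚ
  open import Data.Integer.Properties using (pos-+; pos-*; +-injective; +-identityˡ)
  open import Relation.Nullary using (¬_)
  open import Data.Integer.Tactic.RingSolver using (solve-∀)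
  open import Relation.Binary.PropositionalEquality

  infix 4 _≡_mod_
  infixr 4 _,_

  record _≡_mod_ (u v : ℤ) (q : ℕ) : Set where
    constructor _,_
    field
      quotient : ℤ
      equation : u ≡ v + quotient * + q

  mod-refl : ∀ {q u} → u ≡ u mod q
  mod-refl {q} {u} = + 0 , lemma u (+ q)
    where
    lemma : ∀ u Q → u ≡ u + + 0 * Q
    lemma = solve-∀

  mod-reflexive : ∀ {q u v} → u ≡ v → u ≡ v mod q
  mod-reflexive refl = mod-refl

  mod-sym : ∀ {q u v} → u ≡ v mod q → v ≡ u mod q
  mod-sym {q} {u} {v} (k , refl) = - k , lemma v k (+ q)
    where
    lemma : ∀ v k Q → v ≡ (v + k * Q) + (- k) * Q
    lemma = solve-∀

  mod-trans : ∀ {q u v w} → u ≡ v mod q → v ≡ w mod q → u ≡ w mod q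
  mod-trans {q} {u} {v} {w} (k , refl) (l , refl) = l + k , lemma w l k (+ q)
    where
    lemma : ∀ w l k Q → (w + l * Q) + k * Q ≡ w + (l + k) * Q
    lemma = solve-∀

  mod-+ : ∀ {q u v u′ v′} → u ≡ v mod q → u′ ≡ v′ mod q → u + u′ ≡ v + v′ mod q
  mod-+ {q} {u} {v} {u′} {v′} (k , refl) (l , refl) = k + l , lemma v v′ k l (+ q)
    where
    lemma : ∀ v v′ k l Q → (v + k * Q) + (v′ + l * Q) ≡ (v + v′) + (k + l) * Q
    lemma = solve-∀

  mod-neg : ∀ {q u v} → u ≡ v mod q → - u ≡ - v mod q
  mod-neg {q} {u} {v} (k , refl) = - k , lemma v k (+ q)
    where
    lemma : ∀ v k Q → - (v + k * Q) ≡ - v + (- k) * Q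
    lemma = solve-∀

  mod-cancelˡ : ∀ {q u v w} → u + v ≡ u + w mod q → v ≡ w mod q
  mod-cancelˡ {q} {u} {v} {w} (k , e) = k , trans (lemma₁ u v) (trans (cong (_- u) e) (lemma₂ u w k (+ q)))
    where
    lemma₁ : ∀ u v → v ≡ (u + v) - u
    lemma₁ = solve-∀
    lemma₂ : ∀ u w k Q → ((u + w) + k * Q) - u ≡ w + k * Q
    lemma₂ = solve-∀

  mod-cancelʳ : ∀ {q u v w} → u + w ≡ v + w mod q → u ≡ v mod q
  mod-cancelʳ {q} {u} {v} {w} (k , e) = k , trans (lemma₁ u w) (trans (cong (_- w) e) (lemma₂ v w k (+ q)))
    where
    lemma₁ : ∀ u w → u ≡ (u + w) - w
    lemma₁ = solve-∀
    lemma₂ : ∀ v w k Q → ((v + w) + k * Q) - w ≡ v + k * Q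
    lemma₂ = solve-∀

  positive-below-modulus : ∀ {q h} → 0 ℕ.< h → h ℕ.< q → ¬ (+ h ≡ + 0 mod q)
  positive-below-modulus {suc q} {h} 0<h h<q (+ n , e) with +-injective (trans e (trans (+-identityˡ _) (sym (pos-* n (suc q)))))
  ... | h≡nq with n
  ...   | zero = ℕₚ.<-irrefl (sym h≡nq) 0<h
  ...   | suc n′ = ℕₚ.<-irrefl refl (ℕₚ.<-≤-trans h<q (subst (suc q ℕ.≤_) (sym h≡nq) (ℕₚ.m≤m+n (suc q) (n′ ℕ.* suc q))))
  positive-below-modulus {suc q} 0<h h<q (-[1+ n ] , ())

  mod-divisor : ∀ {q r h u v} → q ≡ r ℕ.* h → u ≡ v mod q → u ≡ v mod h
  mod-divisor {r = r} {h} {v = v} refl (k , e) = k * + r , trans e (trans (cong (λ z → v + k * z) (pos-* r h)) (lemma v k (+ r) (+ h)))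
    where
    lemma : ∀ v k R H → v + k * (R * H) ≡ v + (k * R) * H
    lemma = solve-∀

  module ModReasoning (q : ℕ) where
    infixr 2 _≈⟨_⟩_ _≡⟨_⟩_
    infix 3 _∎
    _≈⟨_⟩_ : ∀ x {y z} → x ≡ y mod q → y ≡ z mod q → x ≡ z mod q
    _ ≈⟨ p ⟩ r = mod-trans p r
    _≡⟨_⟩_ : ∀ x {y z} → x ≡ y → y ≡ z mod q → x ≡ z mod q
    _ ≡⟨ refl ⟩ r = r
    _∎ : ∀ x → x ≡ x mod q
    _ ∎ = mod-refl

  mod⇒%≡ : ∀ q x y .{{_ : ℕ.NonZero q}} → + x ≡ + y mod q → x ℕ.% q ≡ y ℕ.% q
  mod⇒%≡ q x y (+ n , e) =
    trans (cong (ℕ._% q) (+-injective (trans e (trans (cong (λ z → + y + z) (sym (pos-* n q))) (sym (pos-+ y (n ℕ.* q)))))))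
          ([m+kn]%n≡m%n y n q)
  mod⇒%≡ q x y (-[1+ n ] , e) = sym (trans (cong (ℕ._% q) (+-injective y≡x+kq)) ([m+kn]%n≡m%n x (suc n) q))
    where
    lemma : ∀ Y K Q → Y ≡ (Y + K * Q) + (- K) * Q
    lemma = solve-∀
    y≡x+kq : + y ≡ + (x ℕ.+ suc n ℕ.* q)
    y≡x+kq = trans (trans (lemma (+ y) -[1+ n ] (+ q)) (cong (λ z → z + (- -[1+ n ]) * + q) (sym e)))
                   (trans (cong (λ z → + x + z) (sym (pos-* (suc n) q))) (sym (pos-+ x (suc n ℕ.* q))))

  %≡⇒mod : ∀ q x y .{{_ : ℕ.NonZero q}} → x ℕ.% q ≡ y ℕ.% q → + x ≡ + y mod q
  %≡⇒mod q x y e = (+ (x ℕ./ q) - + (y ℕ./ q)) , (begin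
      + x                                                       ≡⟨ split x ⟩
      + (x ℕ.% q) + + (x ℕ./ q) * + q                            ≡⟨ cong (λ z → + z + + (x ℕ./ q) * + q) e ⟩
      + (y ℕ.% q) + + (x ℕ./ q) * + q                            ≡⟨ lemma (+ (y ℕ.% q)) (+ (x ℕ./ q)) (+ (y ℕ./ q)) (+ q) ⟩
      (+ (y ℕ.% q) + + (y ℕ./ q) * + q) + (+ (x ℕ./ q) - + (y ℕ./ q)) * + q
                                                                ≡⟨ cong (_+ (+ (x ℕ./ q) - + (y ℕ./ q)) * + q) (sym (split y)) ⟩
      + y + (+ (x ℕ./ q) - + (y ℕ./ q)) * + q                    ∎)
    where
    open ≡-Reasoning
    split : ∀ z → + z ≡ + (z ℕ.% q) + + (z ℕ./ q) * + q
    split z = trans (cong +_ (m≡m%n+[m/n]*n z q))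
                    (trans (pos-+ (z ℕ.% q) (z ℕ./ q ℕ.* q)) (cong (λ w → + (z ℕ.% q) + w) (pos-* (z ℕ./ q) q)))
    lemma : ∀ R A B Q → R + A * Q ≡ (R + B * Q) + (A - B) * Q
    lemma = solve-∀

module Arithmetic where

  open import Data.Nat
  open import Data.Nat.Properties
  open import Data.Product using (Σ; _×_; _,_)
  open import Data.Empty using (⊥-elim)
  open import Relation.Nullary using (Dec)
  open import Relation.Nullary.Decidable using (map′)
  open import Relation.Binary.PropositionalEquality
  open import Relation.Binary.Definitions using (tri<; tri≈; tri>)

  *+<*+ : ∀ m {j j′ s} t → j < j′ → s < m → m * j + s < m * j′ + t
  *+<*+ m {j} {j′} {s} t j<j′ s<m = begin-strict
    m * j + s   <⟨ +-monoʳ-< (m * j) s<m ⟩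
    m * j + m   ≡⟨ +-comm (m * j) m ⟩
    m + m * j   ≡⟨ *-suc m j ⟨
    m * suc j   ≤⟨ *-monoʳ-≤ m j<j′ ⟩
    m * j′      ≤⟨ m≤m+n (m * j′) t ⟩
    m * j′ + t  ∎
    where open ≤-Reasoning

  quotRem-unique : ∀ m j j′ s t → m * j + s ≡ m * j′ + t → s < m → t < m → j ≡ j′ × s ≡ t
  quotRem-unique m j j′ s t e s<m t<m with <-cmp j j′
  ... | tri≈ _ refl _ = refl , +-cancelˡ-≡ (m * j) s t e
  ... | tri< j<j′ _ _ = ⊥-elim (<-irrefl e (*+<*+ m t j<j′ s<m))
  ... | tri> _ _ j′<j = ⊥-elim (<-irrefl (sym e) (*+<*+ m s j′<j t<m))

  anyUpTo≤? : {P : ℕ → Set} → (∀ n → Dec (P n)) → ∀ N → Dec (Σ ℕ λ n → n ≤ N × P n)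
  anyUpTo≤? P? N = map′ (λ { (n , s≤s n≤N , p) → n , n≤N , p }) (λ { (n , n≤N , p) → n , s≤s n≤N , p })
                        (anyUpTo? P? (suc N))

  offset-quotRem-unique : ∀ a m j j′ s t → a + m * j + s ≡ a + m * j′ + t → s < m → t < m → j ≡ j′ × s ≡ t
  offset-quotRem-unique a m j j′ s t e = quotRem-unique m j j′ s t
    (+-cancelˡ-≡ a _ _ (trans (sym (+-assoc a (m * j) s)) (trans e (+-assoc a (m * j′) t))))

module Grid (m h0 a b R C' : ℕ) (h0<m : h0 < m) (0<h0 : 0 < h0) (1≤a : 1 ≤ a) (1≤b : 1 ≤ b) where

  open import Data.Nat
  open import Data.Nat.Properties
  open import Data.Product using (Σ; _×_; _,_; proj₁; proj₂)
  open import Data.Sum using (_⊎_; inj₁; inj₂)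
  open import Data.Empty using (⊥; ⊥-elim)
  open import Relation.Nullary using (¬_; Dec; yes; no; _×-dec_; _⊎-dec_)
  open import Data.Product.Properties using (≡-dec)
  open import Relation.Binary.PropositionalEquality
  open import Relation.Binary.Definitions using (tri<; tri≈; tri>)
  open Crossing using (Point; Between; between<; between>)
  open Congruence
  open Arithmetic
  open import Data.Integer using (ℤ) renaming (+_ to ι; _+_ to _+ℤ_; _-_ to _-ℤ_; _*_ to _*ℤ_; -_ to -ℤ_)
  open import Data.Integer.Properties as ℤP using (pos-+; pos-*)
  open import Data.Integer.Tactic.RingSolver using (solve-∀)

  0<m : 0 < m
  0<m = <-trans 0<h0 h0<m

  instance
    m≢0 : NonZero m
    m≢0 = >-nonZero 0<m

  W : ℕ
  W = a + m * C' + b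

  Ht : ℕ
  Ht = m * R

  data Arc (p q : Point) : Set where
    row-arc : ∀ i x → i < R → x < W → p ≡ (x , m * i) → q ≡ (suc x , m * i) → Arc p q
    column-arc : ∀ j y → j ≤ C' → y < m * R → p ≡ (a + m * j , y) → q ≡ (a + m * j , suc y) → Arc p q
    top-arc : ∀ j t → j < C' → h0 < t → t < m → p ≡ (a + m * j + t , m * R) →
           q ≡ (a + m * j + suc t , m * R) → Arc p q
    long-arc : ∀ j → j < C' → p ≡ (a + m * j , m * R) → q ≡ (a + m * j + suc h0 , m * R) → Arc p q

  Edge : Point → Point → Set
  Edge p q = Arc p q ⊎ Arc q p

  Edge-sym : ∀ {p q} → Edge p q → Edge q p
  Edge-sym (inj₁ e) = inj₂ e
  Edge-sym (inj₂ e) = inj₁ e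

  IsColumn : ℕ → Set
  IsColumn x = Σ ℕ λ j → j ≤ C' × x ≡ a + m * j

  IsRow : ℕ → Set
  IsRow y = Σ ℕ λ i → i ≤ R × y ≡ m * i

  BranchPoint : Point → Set
  BranchPoint v = IsColumn (proj₁ v) × IsRow (proj₂ v)

  data Direction (p q : Point) : Set where
    rightward : (s : ℕ) → 1 ≤ s → proj₂ p ≡ proj₂ q → proj₁ q ≡ proj₁ p + s → IsRow (proj₂ q) → Direction p q
    upward : proj₁ p ≡ proj₁ q → proj₂ q ≡ suc (proj₂ p) → IsColumn (proj₁ q) → Direction p q

  direction : ∀ {p q} → Arc p q → Direction p q
  direction (row-arc i x i<R x<W refl refl) = rightward 1 ≤-refl refl (+-comm 1 x) (i , <⇒≤ i<R , refl)
  direction (column-arc j y j≤C y<H refl refl) = upward refl refl (j , j≤C , refl)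
  direction (top-arc j t j<C h0<t t<m refl refl) = rightward 1 ≤-refl refl
    (trans (+-suc (a + m * j) t) (+-comm 1 _)) (R , ≤-refl , refl)
  direction (long-arc j j<C refl refl) = rightward (suc h0) (s≤s z≤n) refl refl (R , ≤-refl , refl)

  row≢top : ∀ i → i < R → m * i ≢ m * R
  row≢top i i<R e = <-irrefl (*-cancelˡ-≡ i R m e) i<R

  toBranchPoint : ∀ {v} j i → j ≤ C' → i ≤ R → proj₁ v ≡ a + m * j → proj₂ v ≡ m * i → BranchPoint v
  toBranchPoint j i j≤ i≤ ex ey = (j , j≤ , ex) , (i , i≤ , ey)

  column-step : ∀ j z → z ≡ m → a + m * j + z ≡ a + m * suc j
  column-step j z refl = begin
      a + m * j + m   ≡⟨ +-assoc a (m * j) m ⟩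
      a + (m * j + m) ≡⟨ cong (a +_) (+-comm (m * j) m) ⟩
      a + (m + m * j) ≡⟨ cong (a +_) (*-suc m j) ⟨
      a + m * suc j   ∎
    where open ≡-Reasoning

  top-meets-long : ∀ {v : Point} j t j' → j < C' → j' < C' → h0 < t → t < m →
    proj₁ v ≡ a + m * j + suc t → proj₁ v ≡ a + m * j' + suc h0 → proj₂ v ≡ m * R → BranchPoint v
  top-meets-long {v} j t j' j<C j'<C h0<t t<m e1 e2 ey with m≤n⇒m<n∨m≡n t<m | m≤n⇒m<n∨m≡n h0<m
  ... | inj₂ st≡m | _ = toBranchPoint (suc j) R j<C ≤-refl (trans e1 (column-step j (suc t) st≡m)) ey
  ... | _ | inj₂ sh≡m = toBranchPoint (suc j') R j'<C ≤-refl (trans e2 (column-step j' (suc h0) sh≡m)) ey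
  ... | inj₁ st<m | inj₁ sh<m = ⊥-elim (<-irrefl (sym (suc-injective (proj₂ (offset-quotRem-unique a m j j' (suc t) (suc h0)
          (trans (sym e1) e2) st<m sh<m)))) h0<t)

  arc-in-unique : ∀ {u w v} → Arc u v → Arc w v → ¬ BranchPoint v → u ≡ w
  arc-in-unique (row-arc i x i<R x<W refl refl) (row-arc i' x' _ _ refl ev) nb
    rewrite suc-injective (cong proj₁ ev) | cong proj₂ ev = refl
  arc-in-unique (row-arc i x i<R x<W refl refl) (column-arc j' y' j'≤ _ refl ev) nb =
    ⊥-elim (nb (toBranchPoint j' i j'≤ (<⇒≤ i<R) (cong proj₁ ev) refl))
  arc-in-unique (row-arc i x i<R x<W refl refl) (top-arc j' t' _ _ _ refl ev) nb = ⊥-elim (row≢top i i<R (cong proj₂ ev))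
  arc-in-unique (row-arc i x i<R x<W refl refl) (long-arc j' _ refl ev) nb = ⊥-elim (row≢top i i<R (cong proj₂ ev))
  arc-in-unique (column-arc j y j≤ y< refl refl) (row-arc i' x' i'<R _ refl ev) nb =
    ⊥-elim (nb (toBranchPoint j i' j≤ (<⇒≤ i'<R) refl (cong proj₂ ev)))
  arc-in-unique (column-arc j y j≤ y< refl refl) (column-arc j' y' _ _ refl ev) nb
    rewrite cong proj₁ ev | suc-injective (cong proj₂ ev) = refl
  arc-in-unique (column-arc j y j≤ y< refl refl) (top-arc j' t' _ _ _ refl ev) nb =
    ⊥-elim (nb (toBranchPoint j R j≤ ≤-refl refl (cong proj₂ ev)))
  arc-in-unique (column-arc j y j≤ y< refl refl) (long-arc j' _ refl ev) nb =
    ⊥-elim (nb (toBranchPoint j R j≤ ≤-refl refl (cong proj₂ ev)))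
  arc-in-unique (top-arc j t _ _ _ refl refl) (row-arc i' x' i'<R _ refl ev) nb = ⊥-elim (row≢top i' i'<R (sym (cong proj₂ ev)))
  arc-in-unique (top-arc j t j<C _ _ refl refl) (column-arc j' y' j'≤ _ refl ev) nb =
    ⊥-elim (nb (toBranchPoint j' R j'≤ ≤-refl (cong proj₁ ev) refl))
  arc-in-unique (top-arc j t _ _ _ refl refl) (top-arc j' t' _ _ _ refl ev) nb =
    cong (_, m * R) (suc-injective (trans (sym (+-suc (a + m * j) t)) (trans (cong proj₁ ev) (+-suc (a + m * j') t'))))
  arc-in-unique (top-arc j t j<C h0<t t<m refl refl) (long-arc j' j'<C refl ev) nb =
    ⊥-elim (nb (top-meets-long j t j' j<C j'<C h0<t t<m refl (cong proj₁ ev) refl))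
  arc-in-unique (long-arc j _ refl refl) (row-arc i' x' i'<R _ refl ev) nb = ⊥-elim (row≢top i' i'<R (sym (cong proj₂ ev)))
  arc-in-unique (long-arc j j<C refl refl) (column-arc j' y' j'≤ _ refl ev) nb =
    ⊥-elim (nb (toBranchPoint j' R j'≤ ≤-refl (cong proj₁ ev) refl))
  arc-in-unique (long-arc j j<C refl refl) (top-arc j' t' j'<C h0<t' t'<m refl ev) nb =
    ⊥-elim (nb (top-meets-long j' t' j j'<C j<C h0<t' t'<m (cong proj₁ ev) refl refl))
  arc-in-unique (long-arc j _ refl refl) (long-arc j' _ refl ev) nb
    rewrite *-cancelˡ-≡ j j' m (+-cancelˡ-≡ a _ _ (+-cancelʳ-≡ (suc h0) (a + m * j) (a + m * j') (cong proj₁ ev))) = refl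

  arc-out-unique : ∀ {u w v} → Arc v u → Arc v w → ¬ BranchPoint v → u ≡ w
  arc-out-unique (row-arc i x i<R x<W refl refl) (row-arc i' x' _ _ ev refl) nb
    rewrite cong proj₁ ev | cong proj₂ ev = refl
  arc-out-unique (row-arc i x i<R x<W refl refl) (column-arc j' y' j'≤ _ ev refl) nb =
    ⊥-elim (nb (toBranchPoint j' i j'≤ (<⇒≤ i<R) (cong proj₁ ev) refl))
  arc-out-unique (row-arc i x i<R x<W refl refl) (top-arc j' t' _ _ _ ev refl) nb = ⊥-elim (row≢top i i<R (cong proj₂ ev))
  arc-out-unique (row-arc i x i<R x<W refl refl) (long-arc j' _ ev refl) nb = ⊥-elim (row≢top i i<R (cong proj₂ ev))
  arc-out-unique (column-arc j y j≤ y< refl refl) (row-arc i' x' i'<R _ ev refl) nb =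
    ⊥-elim (nb (toBranchPoint j i' j≤ (<⇒≤ i'<R) refl (cong proj₂ ev)))
  arc-out-unique (column-arc j y j≤ y< refl refl) (column-arc j' y' _ _ ev refl) nb
    rewrite cong proj₁ ev | cong proj₂ ev = refl
  arc-out-unique (column-arc j y j≤ y< refl refl) (top-arc j' t' _ _ _ ev refl) nb =
    ⊥-elim (nb (toBranchPoint j R j≤ ≤-refl refl (cong proj₂ ev)))
  arc-out-unique (column-arc j y j≤ y< refl refl) (long-arc j' _ ev refl) nb =
    ⊥-elim (nb (toBranchPoint j R j≤ ≤-refl refl (cong proj₂ ev)))
  arc-out-unique (top-arc j t _ _ _ refl refl) (row-arc i' x' i'<R _ ev refl) nb = ⊥-elim (row≢top i' i'<R (sym (cong proj₂ ev)))
  arc-out-unique (top-arc j t j<C _ _ refl refl) (column-arc j' y' j'≤ _ ev refl) nb =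
    ⊥-elim (nb (toBranchPoint j' R j'≤ ≤-refl (cong proj₁ ev) refl))
  arc-out-unique (top-arc j t _ _ t<m refl refl) (top-arc j' t' _ _ t'<m ev refl) nb
    with offset-quotRem-unique a m j j' t t' (cong proj₁ ev) t<m t'<m
  ... | refl , refl = refl
  arc-out-unique (top-arc j t j<C h0<t t<m refl refl) (long-arc j' j'<C ev refl) nb =
    ⊥-elim (<-irrefl (sym (proj₂ (offset-quotRem-unique a m j j' t 0 (trans (cong proj₁ ev) (sym (+-identityʳ _))) t<m 0<m))) (≤-trans (s≤s z≤n) h0<t))
  arc-out-unique (long-arc j _ refl refl) (row-arc i' x' i'<R _ ev refl) nb = ⊥-elim (row≢top i' i'<R (sym (cong proj₂ ev)))
  arc-out-unique (long-arc j j<C refl refl) (column-arc j' y' j'≤ _ ev refl) nb =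
    ⊥-elim (nb (toBranchPoint j' R j'≤ ≤-refl (cong proj₁ ev) refl))
  arc-out-unique (long-arc j j<C refl refl) (top-arc j' t' j'<C h0<t' t'<m ev refl) nb =
    ⊥-elim (<-irrefl (proj₂ (offset-quotRem-unique a m j j' 0 t' (trans (+-identityʳ _) (cong proj₁ ev)) 0<m t'<m)) (≤-trans (s≤s z≤n) h0<t'))
  arc-out-unique (long-arc j _ refl refl) (long-arc j' _ ev refl) nb
    rewrite *-cancelˡ-≡ j j' m (+-cancelˡ-≡ a _ _ (cong proj₁ ev)) = refl

  branchPoint? : ∀ v → Dec (BranchPoint v)
  branchPoint? (x , y) = anyUpTo≤? (λ j → x ≟ a + m * j) C' ×-dec anyUpTo≤? (λ i → y ≟ m * i) R

  -- The potential of a step u → v is the coordinate of v in the direction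
  -- of travel, measured from the first column x = a or from y = 0.  It is
  -- ≡ 0 mod m when v is a branch point, and along a path it grows by the
  -- span of each step (potential-step).
  potential : Point → Point → ℤ
  potential (ux , uy) (vx , vy) with ux <? vx | vx <? ux | uy <? vy
  ... | yes _ | _ | _ = ι vx -ℤ ι a
  ... | no _ | yes _ | _ = ι a -ℤ ι vx
  ... | no _ | no _ | yes _ = ι vy
  ... | no _ | no _ | no _ = -ℤ (ι vy)

  potential-right : ∀ ux uy vx vy → ux < vx → potential (ux , uy) (vx , vy) ≡ ι vx -ℤ ι a
  potential-right ux uy vx vy lt with ux <? vx
  ... | yes _ = refl
  ... | no ¬lt = ⊥-elim (¬lt lt)

  potential-left : ∀ ux uy vx vy → vx < ux → potential (ux , uy) (vx , vy) ≡ ι a -ℤ ι vx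
  potential-left ux uy vx vy lt with ux <? vx | vx <? ux
  ... | yes p | _ = ⊥-elim (<-asym p lt)
  ... | no _ | yes _ = refl
  ... | no _ | no ¬lt = ⊥-elim (¬lt lt)

  potential-up : ∀ x uy vy → uy < vy → potential (x , uy) (x , vy) ≡ ι vy
  potential-up x uy vy lt with x <? x | uy <? vy
  ... | yes p | _ = ⊥-elim (<-irrefl refl p)
  ... | no _ | yes _ = refl
  ... | no _ | no ¬lt = ⊥-elim (¬lt lt)

  potential-down : ∀ x uy vy → vy < uy → potential (x , uy) (x , vy) ≡ -ℤ (ι vy)
  potential-down x uy vy lt with x <? x | uy <? vy
  ... | yes p | _ = ⊥-elim (<-irrefl refl p)
  ... | no _ | yes p = ⊥-elim (<-asym p lt)
  ... | no _ | no _ = refl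

  distance : Point → Point → ℕ
  distance (ux , uy) (vx , vy) = ((ux ∸ vx) + (vx ∸ ux)) + ((uy ∸ vy) + (vy ∸ uy))

  forwardPotential : ∀ {u v} → Direction u v → ℤ
  forwardPotential {u} {v} (rightward s _ _ _ _) = ι (proj₁ v) -ℤ ι a
  forwardPotential {u} {v} (upward _ _ _) = ι (proj₂ v)

  backwardPotential : ∀ {u v} → Direction u v → ℤ
  backwardPotential {u} {v} (rightward s _ _ _ _) = ι a -ℤ ι (proj₁ u)
  backwardPotential {u} {v} (upward _ _ _) = -ℤ (ι (proj₂ u))

  directionSpan : ∀ {u v} → Direction u v → ℕ
  directionSpan (rightward s _ _ _ _) = s
  directionSpan (upward _ _ _) = 1

  potential-forward : ∀ {u v} (d : Direction u v) → potential u v ≡ forwardPotential d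
  potential-forward {ux , uy} {vx , vy} (rightward s 1≤s refl refl _) = potential-right ux uy (ux + s) uy (subst (_< ux + s) (+-identityʳ ux) (+-monoʳ-< ux 1≤s))
  potential-forward {ux , uy} {vx , vy} (upward refl refl _) = potential-up ux uy (suc uy) (n<1+n uy)

  potential-backward : ∀ {u v} (d : Direction u v) → potential v u ≡ backwardPotential d
  potential-backward {ux , uy} {vx , vy} (rightward s 1≤s refl refl _) = potential-left (ux + s) uy ux uy (subst (_< ux + s) (+-identityʳ ux) (+-monoʳ-< ux 1≤s))
  potential-backward {ux , uy} {vx , vy} (upward refl refl _) = potential-down ux (suc uy) uy (n<1+n uy)

  distance-forward : ∀ {u v} (d : Direction u v) → distance u v ≡ directionSpan d
  distance-forward {ux , uy} {vx , vy} (rightward s 1≤s refl refl _) rewrite n∸n≡0 uy | m≤n⇒m∸n≡0 (m≤m+n ux s) | m+n∸m≡n ux s = +-identityʳ s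
  distance-forward {ux , uy} {vx , vy} (upward refl refl _) rewrite n∸n≡0 ux | m≤n⇒m∸n≡0 (n≤1+n uy) | m+n∸n≡m 1 uy = refl

  distance-backward : ∀ {u v} (d : Direction u v) → distance v u ≡ directionSpan d
  distance-backward {ux , uy} {vx , vy} (rightward s 1≤s refl refl _) rewrite n∸n≡0 uy | m≤n⇒m∸n≡0 (m≤m+n ux s) | m+n∸m≡n ux s = trans (+-identityʳ (s + 0)) (+-identityʳ s)
  distance-backward {ux , uy} {vx , vy} (upward refl refl _) rewrite n∸n≡0 ux | m≤n⇒m∸n≡0 (n≤1+n uy) | m+n∸n≡m 1 uy = refl

  ι-column : ∀ j → ι (a + m * j) ≡ ι a +ℤ ι m *ℤ ι j
  ι-column j = trans (pos-+ a (m * j)) (cong (ι a +ℤ_) (pos-* m j))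

  ι-suc : ∀ y → ι (suc y) ≡ ι y +ℤ ι 1
  ι-suc y = trans (cong ι (+-comm 1 y)) (pos-+ y 1)

  potential-into-branchPoint : ∀ {u v} → BranchPoint v → Edge u v → potential u v ≡ ι 0 mod m
  potential-into-branchPoint ((j , _ , ex) , (i , _ , ey)) (inj₁ e) with direction e | potential-forward (direction e)
  ... | rightward _ _ _ _ _ | eΦ = ι j , trans eΦ (trans (cong (λ z → ι z -ℤ ι a) ex)
          (trans (cong (_-ℤ ι a) (ι-column j)) (identity (ι a) (ι m) (ι j))))
    where identity : ∀ A M J → (A +ℤ M *ℤ J) -ℤ A ≡ ι 0 +ℤ J *ℤ M
          identity = solve-∀
  ... | upward _ _ _ | eΦ = ι i , trans eΦ (trans (cong ι ey) (trans (pos-* m i) (identity (ι m) (ι i))))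
    where identity : ∀ M I → M *ℤ I ≡ ι 0 +ℤ I *ℤ M
          identity = solve-∀
  potential-into-branchPoint ((j , _ , ex) , (i , _ , ey)) (inj₂ e) with direction e | potential-backward (direction e)
  ... | rightward _ _ _ _ _ | eΦ = -ℤ ι j , trans eΦ (trans (cong (λ z → ι a -ℤ ι z) ex)
          (trans (cong (λ z → ι a -ℤ z) (ι-column j)) (identity (ι a) (ι m) (ι j))))
    where identity : ∀ A M J → A -ℤ (A +ℤ M *ℤ J) ≡ ι 0 +ℤ (-ℤ J) *ℤ M
          identity = solve-∀
  ... | upward _ _ _ | eΦ = -ℤ ι i , trans eΦ (trans (cong (λ z → -ℤ ι z) ey) (trans (cong -ℤ_ (pos-* m i)) (identity (ι m) (ι i))))
    where identity : ∀ M I → -ℤ (M *ℤ I) ≡ ι 0 +ℤ (-ℤ I) *ℤ M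
          identity = solve-∀

  potential-out-of-branchPoint : ∀ {v w} → BranchPoint v → Edge v w → potential v w ≡ ι (distance v w) mod m
  potential-out-of-branchPoint ((j , _ , ex) , (i , _ , ey)) (inj₁ e)
    with direction e | potential-forward (direction e) | distance-forward (direction e)
  ... | rightward s _ _ ew _ | eΦ | esp rewrite esp = ι j , trans eΦ (trans (cong (λ z → ι z -ℤ ι a) (trans ew (cong (_+ s) ex)))
          (trans (cong (_-ℤ ι a) (trans (pos-+ (a + m * j) s) (cong (_+ℤ ι s) (ι-column j)))) (identity (ι a) (ι m) (ι j) (ι s))))
    where identity : ∀ A M J S → ((A +ℤ M *ℤ J) +ℤ S) -ℤ A ≡ S +ℤ J *ℤ M
          identity = solve-∀
  ... | upward _ ew _ | eΦ | esp rewrite esp = ι i , trans eΦ (trans (cong ι (trans ew (cong suc ey)))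
          (trans (trans (ι-suc (m * i)) (cong (_+ℤ ι 1) (pos-* m i))) (identity (ι m) (ι i))))
    where identity : ∀ M I → M *ℤ I +ℤ ι 1 ≡ ι 1 +ℤ I *ℤ M
          identity = solve-∀
  potential-out-of-branchPoint {w = w} ((j , _ , ex) , (i , _ , ey)) (inj₂ e)
    with direction e | potential-backward (direction e) | distance-backward (direction e)
  ... | rightward s _ _ ew _ | eΦ | esp rewrite esp = -ℤ ι j , trans eΦ (identity (ι a) (ι (proj₁ w)) (ι s) (ι m) (ι j)
          (trans (sym (pos-+ (proj₁ w) s)) (trans (cong ι (trans (sym ew) ex)) (ι-column j))))
    where
    identity : ∀ A X S M J → X +ℤ S ≡ A +ℤ M *ℤ J → A -ℤ X ≡ S +ℤ (-ℤ J) *ℤ M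
    identity A X S M J e = trans (lemma₁ A X M J) (trans (cong (λ z → (z -ℤ X) -ℤ M *ℤ J) (sym e)) (lemma₂ X S M J))
      where
      lemma₁ : ∀ A X M J → A -ℤ X ≡ ((A +ℤ M *ℤ J) -ℤ X) -ℤ M *ℤ J
      lemma₁ = solve-∀
      lemma₂ : ∀ X S M J → ((X +ℤ S) -ℤ X) -ℤ M *ℤ J ≡ S +ℤ (-ℤ J) *ℤ M
      lemma₂ = solve-∀
  ... | upward _ ew _ | eΦ | esp rewrite esp = -ℤ ι i , trans eΦ (identity (ι (proj₂ w)) (ι m) (ι i)
          (trans (sym (pos-+ (proj₂ w) 1)) (trans (cong ι (trans (+-comm (proj₂ w) 1) (trans (sym ew) ey))) (pos-* m i))))
    where
    identity : ∀ Y M I → Y +ℤ ι 1 ≡ M *ℤ I → -ℤ Y ≡ ι 1 +ℤ (-ℤ I) *ℤ M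
    identity Y M I e = trans (lemma₁ Y) (trans (cong (λ z → ι 1 -ℤ z) e) (lemma₂ M I))
      where
      lemma₁ : ∀ Y → -ℤ Y ≡ ι 1 -ℤ (Y +ℤ ι 1)
      lemma₁ = solve-∀
      lemma₂ : ∀ M I → ι 1 -ℤ M *ℤ I ≡ ι 1 +ℤ (-ℤ I) *ℤ M
      lemma₂ = solve-∀

  -- Consecutive steps u → v → w: at a branch point both potentials are
  -- multiples of m; elsewhere the path goes straight on, since the grid has
  -- at most one arc into and one arc out of every other point.
  potential-step : ∀ {u v w} → Edge u v → Edge v w → u ≢ w →
    potential v w ≡ potential u v +ℤ ι (distance v w) mod m
  potential-step {u} {v} {w} euv evw u≢w with branchPoint? v
  ... | yes br = mod-trans (potential-out-of-branchPoint br evw)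
        (mod-sym (mod-+ (potential-into-branchPoint br euv) (mod-refl {u = ι (distance v w)})))
  potential-step {u} {v} {w} (inj₁ e1) (inj₁ e2) u≢w | no nb
    with direction e1 | potential-forward (direction e1) | direction e2 | potential-forward (direction e2) | distance-forward (direction e2)
  ... | rightward _ _ _ _ _ | f1 | rightward s2 _ _ ew _ | f2 | stepLength rewrite f1 | f2 | stepLength | ew = mod-reflexive (identity (proj₁ v) (ι a) s2)
    where
    identity : ∀ X A S → ι (X + S) -ℤ A ≡ (ι X -ℤ A) +ℤ ι S
    identity X A S = trans (cong (_-ℤ A) (pos-+ X S)) (lemma (ι X) A (ι S))
      where lemma : ∀ X A S → (X +ℤ S) -ℤ A ≡ (X -ℤ A) +ℤ S
            lemma = solve-∀
  ... | upward _ _ _ | f1 | upward _ ew _ | f2 | stepLength rewrite f1 | f2 | stepLength | ew = mod-reflexive (ι-suc (proj₂ v))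
  ... | rightward _ _ _ _ r1 | _ | upward ex _ c2 | _ | _ = ⊥-elim (nb (subst IsColumn (sym ex) c2 , r1))
  ... | upward _ _ c1 | _ | rightward _ _ ey _ r2 | _ | _ = ⊥-elim (nb (c1 , subst IsRow (sym ey) r2))
  potential-step {u} {v} {w} (inj₂ e1) (inj₂ e2) u≢w | no nb
    with direction e1 | potential-backward (direction e1) | direction e2 | potential-backward (direction e2) | distance-backward (direction e2)
  ... | rightward _ _ _ _ _ | f1 | rightward s2 _ _ ew _ | f2 | stepLength rewrite f1 | f2 | stepLength | ew = mod-reflexive (identity (ι a) (proj₁ w) s2)
    where
    identity : ∀ A X S → A -ℤ ι X ≡ (A -ℤ ι (X + S)) +ℤ ι S
    identity A X S = trans (lemma A (ι X) (ι S)) (cong (λ z → (A -ℤ z) +ℤ ι S) (sym (pos-+ X S)))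
      where lemma : ∀ A X S → A -ℤ X ≡ (A -ℤ (X +ℤ S)) +ℤ S
            lemma = solve-∀
  ... | upward _ _ _ | f1 | upward _ ew _ | f2 | stepLength rewrite f1 | f2 | stepLength | ew = mod-reflexive (identity (proj₂ w))
    where
    identity : ∀ Y → -ℤ ι Y ≡ (-ℤ ι (suc Y)) +ℤ ι 1
    identity Y = trans (lemma (ι Y)) (cong (λ z → (-ℤ z) +ℤ ι 1) (sym (ι-suc Y)))
      where lemma : ∀ Y → -ℤ Y ≡ (-ℤ (Y +ℤ ι 1)) +ℤ ι 1
            lemma = solve-∀
  ... | rightward _ _ ey _ r1 | _ | upward _ _ c2 | _ | _ = ⊥-elim (nb (c2 , subst IsRow (sym ey) r1))
  ... | upward ex _ c1 | _ | rightward _ _ _ _ r2 | _ | _ = ⊥-elim (nb (subst IsColumn (sym ex) c1 , r2))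
  potential-step (inj₁ e1) (inj₂ e2) u≢w | no nb = ⊥-elim (u≢w (arc-in-unique e1 e2 nb))
  potential-step (inj₂ e1) (inj₁ e2) u≢w | no nb = ⊥-elim (u≢w (arc-out-unique e1 e2 nb))

  edge-distance : ∀ {p q} → Edge p q → (distance p q ≡ 1) ⊎ ((distance p q ≡ suc h0) × (proj₂ p ≡ Ht))
  edge-distance (inj₁ e@(row-arc _ _ _ _ refl refl)) = inj₁ (distance-forward (direction e))
  edge-distance (inj₁ e@(column-arc _ _ _ _ refl refl)) = inj₁ (distance-forward (direction e))
  edge-distance (inj₁ e@(top-arc _ _ _ _ _ refl refl)) = inj₁ (distance-forward (direction e))
  edge-distance (inj₁ e@(long-arc _ _ refl refl)) = inj₂ (distance-forward (direction e) , refl)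
  edge-distance (inj₂ e@(row-arc _ _ _ _ refl refl)) = inj₁ (distance-backward (direction e))
  edge-distance (inj₂ e@(column-arc _ _ _ _ refl refl)) = inj₁ (distance-backward (direction e))
  edge-distance (inj₂ e@(top-arc _ _ _ _ _ refl refl)) = inj₁ (distance-backward (direction e))
  edge-distance (inj₂ e@(long-arc _ _ refl refl)) = inj₂ (distance-backward (direction e) , refl)

  partialSum : ℕ → (ℕ → ℕ) → ℕ
  partialSum zero f = 0
  partialSum (suc n) f = partialSum n f + f n

  record Walk : Set where
    field
      L : ℕ
      pt : ℕ → Point
      pt-step : ∀ k → k < L → Edge (pt k) (pt (suc k))
      pt-injective : ∀ j k → j ≤ L → k ≤ L → pt j ≡ pt k → j ≡ k

  module _ (P : Walk) where
    open Walk P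

    stepPotential : ℕ → ℤ
    stepPotential k = potential (pt k) (pt (suc k))

    stepLength : ℕ → ℕ
    stepLength k = distance (pt k) (pt (suc k))

    potential-telescope : ∀ k → k < L →
      stepPotential k +ℤ ι (stepLength 0) ≡ stepPotential 0 +ℤ ι (partialSum (suc k) stepLength) mod m
    potential-telescope zero _ = mod-refl
    potential-telescope (suc k) sk<L =
        stepPotential (suc k) +ℤ ι (stepLength 0)
      ≈⟨ mod-+ step (mod-refl {u = ι (stepLength 0)}) ⟩
        (stepPotential k +ℤ ι (stepLength (suc k))) +ℤ ι (stepLength 0)
      ≡⟨ swap (stepPotential k) (ι (stepLength (suc k))) (ι (stepLength 0)) ⟩
        (stepPotential k +ℤ ι (stepLength 0)) +ℤ ι (stepLength (suc k))
      ≈⟨ mod-+ (potential-telescope k (<-trans (n<1+n k) sk<L)) (mod-refl {u = ι (stepLength (suc k))}) ⟩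
        (stepPotential 0 +ℤ ι (partialSum (suc k) stepLength)) +ℤ ι (stepLength (suc k))
      ≡⟨ trans (assoc (stepPotential 0) (ι (partialSum (suc k) stepLength)) (ι (stepLength (suc k))))
               (cong (stepPotential 0 +ℤ_) (sym (pos-+ (partialSum (suc k) stepLength) (stepLength (suc k))))) ⟩
        stepPotential 0 +ℤ ι (partialSum (suc (suc k)) stepLength) ∎
      where
      open ModReasoning m
      step : stepPotential (suc k) ≡ stepPotential k +ℤ ι (stepLength (suc k)) mod m
      step = potential-step (pt-step k (<-trans (n<1+n k) sk<L)) (pt-step (suc k) sk<L)
               (λ e → <-irrefl (pt-injective k (suc (suc k)) (≤-trans (n≤1+n k) (<⇒≤ sk<L)) sk<L e)
                                (≤-trans (n<1+n k) (n≤1+n (suc k))))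
      swap : ∀ A B C → (A +ℤ B) +ℤ C ≡ (A +ℤ C) +ℤ B
      swap = solve-∀
      assoc : ∀ A B C → (A +ℤ B) +ℤ C ≡ A +ℤ (B +ℤ C)
      assoc = solve-∀

    stepLength≡1-mod-h0 : ∀ k → k < L → ι (stepLength k) ≡ ι 1 mod h0
    stepLength≡1-mod-h0 k k<L with edge-distance (pt-step k k<L)
    ... | inj₁ e = mod-reflexive (cong ι e)
    ... | inj₂ (e , _) rewrite e = ι 1 , trans (ι-suc h0) (identity (ι h0))
      where
      identity : ∀ H → H +ℤ ι 1 ≡ ι 1 +ℤ ι 1 *ℤ H
      identity = solve-∀

    stepLengths≡steps-mod-h0 : ∀ n → n ≤ L → ι (partialSum n stepLength) ≡ ι n mod h0
    stepLengths≡steps-mod-h0 zero _ = mod-refl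
    stepLengths≡steps-mod-h0 (suc n) sn≤L =
        ι (partialSum n stepLength + stepLength n)
      ≡⟨ pos-+ (partialSum n stepLength) (stepLength n) ⟩
        ι (partialSum n stepLength) +ℤ ι (stepLength n)
      ≈⟨ mod-+ (stepLengths≡steps-mod-h0 n (<⇒≤ sn≤L)) (stepLength≡1-mod-h0 n sn≤L) ⟩
        ι n +ℤ ι 1
      ≡⟨ trans (sym (pos-+ n 1)) (cong ι (+-comm n 1)) ⟩
        ι (suc n) ∎
      where open ModReasoning h0

    stepLengths≡steps-off-top : ∀ n → n ≤ L → (∀ k → k < n → proj₂ (pt k) ≢ Ht) → partialSum n stepLength ≡ n
    stepLengths≡steps-off-top zero _ _ = refl
    stepLengths≡steps-off-top (suc n) sn≤L off-top
      rewrite stepLengths≡steps-off-top n (<⇒≤ sn≤L) (λ k k<n → off-top k (<-trans k<n (n<1+n n)))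
      with edge-distance (pt-step n sn≤L)
    ... | inj₁ e rewrite e = +-comm n 1
    ... | inj₂ (_ , e) = ⊥-elim (off-top n ≤-refl e)

  LeftTerminal : Point → Set
  LeftTerminal p = Σ ℕ λ i → i < R × p ≡ (0 , m * i)

  RightTerminal : Point → Set
  RightTerminal p = Σ ℕ λ i → i < R × p ≡ (W , m * i)

  Terminal : Point → Set
  Terminal p = LeftTerminal p ⊎ RightTerminal p

  terminal? : ∀ p → Dec (Terminal p)
  terminal? p = anyUpTo? (λ i → ≡-dec _≟_ _≟_ p (0 , m * i)) R ⊎-dec anyUpTo? (λ i → ≡-dec _≟_ _≟_ p (W , m * i)) R

  a+≢0 : ∀ z → a + z ≢ 0
  a+≢0 z e = <-irrefl (sym (m+n≡0⇒m≡0 a e)) 1≤a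

  column<W : ∀ j → j ≤ C' → a + m * j < W
  column<W j j≤ = begin-strict
      a + m * j ≤⟨ +-monoʳ-≤ a (*-monoʳ-≤ m j≤) ⟩
      a + m * C' <⟨ m<m+n (a + m * C') 1≤b ⟩
      W ∎
    where open ≤-Reasoning

  top<W : ∀ j t → j < C' → t ≤ m → a + m * j + t < W
  top<W j t j< t≤ = begin-strict
      a + m * j + t ≤⟨ +-monoʳ-≤ (a + m * j) t≤ ⟩
      a + m * j + m ≡⟨ column-step j m refl ⟩
      a + m * suc j <⟨ column<W (suc j) j< ⟩
      W ∎
    where open ≤-Reasoning

  1≤W : 1 ≤ W
  1≤W = ≤-trans (s≤s z≤n) (column<W 0 z≤n)

  left-terminal-neighbour : ∀ {y q} → Edge (0 , y) q → q ≡ (1 , y)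
  left-terminal-neighbour (inj₁ (row-arc i x _ _ e1 refl)) rewrite sym (cong proj₁ e1) | cong proj₂ e1 = refl
  left-terminal-neighbour (inj₁ (column-arc j y' _ _ e1 _)) = ⊥-elim (a+≢0 _ (sym (cong proj₁ e1)))
  left-terminal-neighbour (inj₁ (top-arc j t _ _ _ e1 _)) = ⊥-elim (a+≢0 (m * j + t) (trans (sym (+-assoc a (m * j) t)) (sym (cong proj₁ e1))))
  left-terminal-neighbour (inj₁ (long-arc j _ e1 _)) = ⊥-elim (a+≢0 _ (sym (cong proj₁ e1)))
  left-terminal-neighbour (inj₂ (row-arc i x _ _ _ e2)) = ⊥-elim (0≢1+n (cong proj₁ e2))
  left-terminal-neighbour (inj₂ (column-arc j y' _ _ _ e2)) = ⊥-elim (a+≢0 _ (sym (cong proj₁ e2)))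
  left-terminal-neighbour (inj₂ (top-arc j t _ _ _ _ e2)) = ⊥-elim (a+≢0 (m * j + suc t) (trans (sym (+-assoc a (m * j) (suc t))) (sym (cong proj₁ e2))))
  left-terminal-neighbour (inj₂ (long-arc j _ _ e2)) = ⊥-elim (a+≢0 (m * j + suc h0) (trans (sym (+-assoc a (m * j) (suc h0))) (sym (cong proj₁ e2))))

  right-terminal-neighbour : ∀ {y q} → Edge (W , y) q → q ≡ (W ∸ 1 , y)
  right-terminal-neighbour (inj₁ (row-arc i x _ x<W e1 _)) = ⊥-elim (<-irrefl (sym (cong proj₁ e1)) x<W)
  right-terminal-neighbour (inj₁ (column-arc j y' j≤ _ e1 _)) = ⊥-elim (<-irrefl (sym (cong proj₁ e1)) (column<W j j≤))
  right-terminal-neighbour (inj₁ (top-arc j t j< _ t<m e1 _)) = ⊥-elim (<-irrefl (sym (cong proj₁ e1)) (top<W j t j< (<⇒≤ t<m)))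
  right-terminal-neighbour (inj₁ (long-arc j j< e1 _)) = ⊥-elim (<-irrefl (sym (cong proj₁ e1)) (column<W j (<⇒≤ j<)))
  right-terminal-neighbour (inj₂ (row-arc i x _ _ refl e2)) rewrite sym (cong proj₂ e2) | cong proj₁ e2 = refl
  right-terminal-neighbour (inj₂ (column-arc j y' j≤ _ _ e2)) = ⊥-elim (<-irrefl (sym (cong proj₁ e2)) (column<W j j≤))
  right-terminal-neighbour (inj₂ (top-arc j t j< _ t<m _ e2)) = ⊥-elim (<-irrefl (sym (cong proj₁ e2)) (top<W j (suc t) j< t<m))
  right-terminal-neighbour (inj₂ (long-arc j j< _ e2)) = ⊥-elim (<-irrefl (sym (cong proj₁ e2)) (top<W j (suc h0) j< h0<m))

  d≢d+h0 : ∀ d → ¬ (ι d ≡ ι (d + h0) mod m)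
  d≢d+h0 d d≡d+h0 = positive-below-modulus 0<h0 h0<m (mod-sym (mod-cancelˡ {u = ι d} {v = ι 0}
    (mod-trans (mod-reflexive (ℤP.+-identityʳ (ι d))) (mod-trans d≡d+h0 (mod-reflexive (pos-+ d h0))))))

  LeftRightViaTop : Walk → Set
  LeftRightViaTop P = ((LeftTerminal (pt 0) × RightTerminal (pt L)) ⊎ (RightTerminal (pt 0) × LeftTerminal (pt L))) ×
                      (Σ ℕ λ k → k < L × proj₂ (pt k) ≡ Ht)
    where open Walk P

  -- The classification of A-paths of length ≡ d (mod m) by their ends:
  -- the hypotheses on a, b and d rule out left-left and right-right paths,
  -- and force left-right paths to use a long edge on the top row.
  module Classify (d : ℕ) (a+b≡d+h0 : ι (a + b) ≡ ι (d + h0) mod m)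
    (d≢2a : ¬ (ι d ≡ ι (a + a) mod h0)) (d≢2b : ¬ (ι d ≡ ι (b + b) mod h0))
    (r : ℕ) (m≡r*h0 : m ≡ r * h0) where

    mod-m⇒mod-h0 : ∀ {u v} → u ≡ v mod m → u ≡ v mod h0
    mod-m⇒mod-h0 = mod-divisor {r = r} {h0} m≡r*h0

    W≡a+b+C'm : ι W ≡ (ι a +ℤ ι b) +ℤ ι C' *ℤ ι m
    W≡a+b+C'm = trans (cong ι (trans (+-assoc a (m * C') b) (trans (cong (a +_) (+-comm (m * C') b)) (sym (+-assoc a b (m * C'))))))
                  (trans (pos-+ (a + b) (m * C')) (cong₂ _+ℤ_ (pos-+ a b) (trans (pos-* m C') (ℤP.*-comm (ι m) (ι C')))))

    W≡a+b : ι W ≡ ι (a + b) mod m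
    W≡a+b = ι C' , trans W≡a+b+C'm (cong (_+ℤ ι C' *ℤ ι m) (sym (pos-+ a b)))

    W∸1<W : W ∸ 1 < W
    W∸1<W = subst (W ∸ 1 <_) (m+[n∸m]≡n 1≤W) (n<1+n (W ∸ 1))

    ι[W∸1]+1 : ι (W ∸ 1) +ℤ ι 1 ≡ ι W
    ι[W∸1]+1 = trans (sym (pos-+ (W ∸ 1) 1)) (cong ι (trans (+-comm (W ∸ 1) 1) (m+[n∸m]≡n 1≤W)))

    module _ (P : Walk) (1≤L : 1 ≤ Walk.L P) where
      open Walk P

      L' : ℕ
      L' = L ∸ 1

      L'+1≡L : suc L' ≡ L
      L'+1≡L = m+[n∸m]≡n 1≤L

      L'<L : L' < L
      L'<L = subst (L' <_) L'+1≡L (n<1+n L')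

      last-edge : Edge (pt L) (pt L')
      last-edge = Edge-sym (subst (λ z → Edge (pt L') (pt z)) L'+1≡L (pt-step L' L'<L))

      last-potential : stepPotential P L' ≡ potential (pt L') (pt L)
      last-potential = cong (λ z → potential (pt L') (pt z)) L'+1≡L

      first-step-left : LeftTerminal (pt 0) → (stepLength P 0 ≡ 1) × (stepPotential P 0 ≡ ι 1 -ℤ ι a)
      first-step-left (i , _ , e0) with pt 0 | pt 1 | pt-step 0 1≤L
      ... | _ | _ | st rewrite e0 with left-terminal-neighbour st
      ... | refl rewrite n∸n≡0 (m * i) = refl , potential-right 0 (m * i) 1 (m * i) (s≤s z≤n)

      first-step-right : RightTerminal (pt 0) → (stepLength P 0 ≡ 1) × (stepPotential P 0 ≡ ι a -ℤ ι (W ∸ 1))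
      first-step-right (i , _ , e0) with pt 0 | pt 1 | pt-step 0 1≤L
      ... | _ | _ | st rewrite e0 with right-terminal-neighbour st
      ... | refl rewrite n∸n≡0 (m * i) | m∸[m∸n]≡n 1≤W | m≤n⇒m∸n≡0 (<⇒≤ W∸1<W) =
        refl , potential-left W (m * i) (W ∸ 1) (m * i) W∸1<W

      last-step-left : LeftTerminal (pt L) → stepPotential P L' ≡ ι a
      last-step-left (i , _ , eL) with pt L | pt L' | last-edge | last-potential
      ... | _ | _ | le | f rewrite eL with left-terminal-neighbour le
      ... | refl = trans f (trans (potential-left 1 (m * i) 0 (m * i) (s≤s z≤n)) (ℤP.+-identityʳ (ι a)))

      last-step-right : RightTerminal (pt L) → stepPotential P L' ≡ ι W -ℤ ι a
      last-step-right (i , _ , eL) with pt L | pt L' | last-edge | last-potential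
      ... | _ | _ | le | f rewrite eL with right-terminal-neighbour le
      ... | refl = trans f (potential-right (W ∸ 1) (m * i) W (m * i) W∸1<W)

      geometricLength : ℕ
      geometricLength = partialSum L (stepLength P)

      geometricLength≡ : stepLength P 0 ≡ 1 →
        ι geometricLength ≡ stepPotential P L' +ℤ ι 1 -ℤ stepPotential P 0 mod m
      geometricLength≡ s0 = mod-trans (mod-reflexive (identity (stepPotential P 0) (ι geometricLength)))
        (mod-+ (mod-sym telescope) (mod-refl {u = -ℤ stepPotential P 0}))
        where
        identity : ∀ Y T → T ≡ (Y +ℤ T) -ℤ Y
        identity = solve-∀
        telescope : stepPotential P L' +ℤ ι 1 ≡ stepPotential P 0 +ℤ ι geometricLength mod m
        telescope = subst₂ (λ u v → stepPotential P L' +ℤ ι u ≡ stepPotential P 0 +ℤ ι (partialSum v (stepLength P)) mod m)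
                      s0 L'+1≡L (potential-telescope P L' L'<L)

      left-left : LeftTerminal (pt 0) → LeftTerminal (pt L) → ι geometricLength ≡ ι (a + a) mod m
      left-left l0 lL with first-step-left l0
      ... | s0 , f0 = mod-trans (geometricLength≡ s0) (mod-reflexive
                        (trans (cong₂ (λ u v → u +ℤ ι 1 -ℤ v) (last-step-left lL) f0) (trans (identity (ι a)) (sym (pos-+ a a)))))
        where
        identity : ∀ A → (A +ℤ ι 1) -ℤ (ι 1 -ℤ A) ≡ A +ℤ A
        identity = solve-∀

      left-right : LeftTerminal (pt 0) → RightTerminal (pt L) → ι geometricLength ≡ ι W mod m
      left-right l0 rL with first-step-left l0
      ... | s0 , f0 = mod-trans (geometricLength≡ s0) (mod-reflexive
                        (trans (cong₂ (λ u v → u +ℤ ι 1 -ℤ v) (last-step-right rL) f0) (identity (ι W) (ι a))))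
        where
        identity : ∀ W A → ((W -ℤ A) +ℤ ι 1) -ℤ (ι 1 -ℤ A) ≡ W
        identity = solve-∀

      right-left : RightTerminal (pt 0) → LeftTerminal (pt L) → ι geometricLength ≡ ι W mod m
      right-left r0 lL with first-step-right r0
      ... | s0 , f0 = mod-trans (geometricLength≡ s0) (mod-reflexive
                        (trans (cong₂ (λ u v → u +ℤ ι 1 -ℤ v) (last-step-left lL) f0) (trans (identity (ι a) (ι (W ∸ 1))) ι[W∸1]+1)))
        where
        identity : ∀ A V → (A +ℤ ι 1) -ℤ (A -ℤ V) ≡ V +ℤ ι 1
        identity = solve-∀

      right-right : RightTerminal (pt 0) → RightTerminal (pt L) → ι geometricLength ≡ ι (b + b) mod m
      right-right r0 rL with first-step-right r0
      ... | s0 , f0 = mod-trans (geometricLength≡ s0) (ι C' +ℤ ι C' , (begin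
          stepPotential P L' +ℤ ι 1 -ℤ stepPotential P 0  ≡⟨ cong₂ (λ u v → u +ℤ ι 1 -ℤ v) (last-step-right rL) f0 ⟩
          ((ι W -ℤ ι a) +ℤ ι 1) -ℤ (ι a -ℤ ι (W ∸ 1))       ≡⟨ identity₁ (ι W) (ι a) (ι (W ∸ 1)) ⟩
          ((ι (W ∸ 1) +ℤ ι 1) +ℤ ι W) -ℤ ι a -ℤ ι a         ≡⟨ cong (λ z → (z +ℤ ι W) -ℤ ι a -ℤ ι a) ι[W∸1]+1 ⟩
          (ι W +ℤ ι W) -ℤ ι a -ℤ ι a                        ≡⟨ cong (λ z → (z +ℤ z) -ℤ ι a -ℤ ι a) W≡a+b+C'm ⟩
          _                                                 ≡⟨ identity₂ (ι a) (ι b) (ι C') (ι m) ⟩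
          (ι b +ℤ ι b) +ℤ (ι C' +ℤ ι C') *ℤ ι m             ≡⟨ cong (λ z → z +ℤ (ι C' +ℤ ι C') *ℤ ι m) (sym (pos-+ b b)) ⟩
          ι (b + b) +ℤ (ι C' +ℤ ι C') *ℤ ι m                ∎))
        where
        open ≡-Reasoning
        identity₁ : ∀ W A V → ((W -ℤ A) +ℤ ι 1) -ℤ (A -ℤ V) ≡ ((V +ℤ ι 1) +ℤ W) -ℤ A -ℤ A
        identity₁ = solve-∀
        identity₂ : ∀ A B C M → ((A +ℤ B) +ℤ C *ℤ M) +ℤ ((A +ℤ B) +ℤ C *ℤ M) -ℤ A -ℤ A ≡ (B +ℤ B) +ℤ (C +ℤ C) *ℤ M
        identity₂ = solve-∀

      reaches-top : ι geometricLength ≡ ι W mod m → ι L ≡ ι d mod m → Σ ℕ λ k → k < L × proj₂ (pt k) ≡ Ht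
      reaches-top geo≡W L≡d with anyUpTo? (λ k → proj₂ (pt k) ≟ Ht) L
      ... | yes top = top
      ... | no ¬top = ⊥-elim (d≢d+h0 d (mod-trans (mod-sym L≡d) (mod-trans
              (subst (λ z → ι z ≡ ι W mod m) (stepLengths≡steps-off-top P L ≤-refl (λ k k<L e → ¬top (k , k<L , e))) geo≡W)
              (mod-trans W≡a+b a+b≡d+h0))))

      classify : Terminal (pt 0) → Terminal (pt L) → ι L ≡ ι d mod m → LeftRightViaTop P
      classify (inj₁ l0) (inj₁ lL) L≡d = ⊥-elim (d≢2a (mod-trans (mod-sym (mod-m⇒mod-h0 L≡d))
        (mod-trans (mod-sym (stepLengths≡steps-mod-h0 P L ≤-refl)) (mod-m⇒mod-h0 (left-left l0 lL)))))
      classify (inj₂ r0) (inj₂ rL) L≡d = ⊥-elim (d≢2b (mod-trans (mod-sym (mod-m⇒mod-h0 L≡d))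
        (mod-trans (mod-sym (stepLengths≡steps-mod-h0 P L ≤-refl)) (mod-m⇒mod-h0 (right-right r0 rL)))))
      classify (inj₁ l0) (inj₂ rL) L≡d = inj₁ (l0 , rL) , reaches-top (left-right l0 rL) L≡d
      classify (inj₂ r0) (inj₁ lL) L≡d = inj₂ (r0 , lL) , reaches-top (right-left r0 lL) L≡d

  -- Walks assembled from pieces; a strictly increasing key makes them injective.
  module Routes (key : Point → ℕ) (Inside : Point → Set) where

    record Route : Set where
      field
        len            : ℕ
        at             : ℕ → Point
        step           : ∀ k → k < len → Edge (at k) (at (suc k))
        key-increasing : ∀ k → k < len → key (at k) < key (at (suc k))
        inside         : ∀ k → k ≤ len → Inside (at k)

    open Route

    module Concat (R₁ R₂ : Route) (joined : at R₁ (len R₁) ≡ at R₂ 0) where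

      concatAt : ℕ → Point
      concatAt k with k ≤? len R₁
      ... | yes _ = at R₁ k
      ... | no _ = at R₂ (k ∸ len R₁)

      concatAt-first : ∀ k → k ≤ len R₁ → concatAt k ≡ at R₁ k
      concatAt-first k k≤ with k ≤? len R₁
      ... | yes _ = refl
      ... | no k≰ = ⊥-elim (k≰ k≤)

      concatAt-second : ∀ k → len R₁ ≤ k → concatAt k ≡ at R₂ (k ∸ len R₁)
      concatAt-second k l≤k with k ≤? len R₁
      ... | no _ = refl
      ... | yes k≤ with ≤-antisym k≤ l≤k
      ...   | refl = trans joined (cong (at R₂) (sym (n∸n≡0 k)))

      concat-stepwise : (Rel : Point → Point → Set) →
        (∀ k → k < len R₁ → Rel (at R₁ k) (at R₁ (suc k))) → (∀ k → k < len R₂ → Rel (at R₂ k) (at R₂ (suc k))) →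
        ∀ k → k < len R₁ + len R₂ → Rel (concatAt k) (concatAt (suc k))
      concat-stepwise Rel rel₁ rel₂ k k< = by-cases (k <? len R₁)
        where
        by-cases : Dec (k < len R₁) → Rel (concatAt k) (concatAt (suc k))
        by-cases (yes k<l) = subst₂ Rel (sym (concatAt-first k (<⇒≤ k<l))) (sym (concatAt-first (suc k) k<l)) (rel₁ k k<l)
        by-cases (no k≮l) = subst₂ Rel (sym (concatAt-second k l≤k))
                              (sym (trans (concatAt-second (suc k) (m≤n⇒m≤1+n l≤k)) (cong (at R₂) (+-∸-assoc 1 l≤k))))
                              (rel₂ (k ∸ len R₁) (subst (k ∸ len R₁ <_) (m+n∸m≡n (len R₁) (len R₂)) (∸-monoˡ-< k< l≤k)))
          where
          l≤k : len R₁ ≤ k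
          l≤k = ≮⇒≥ k≮l

      concat-inside : ∀ k → k ≤ len R₁ + len R₂ → Inside (concatAt k)
      concat-inside k k≤ with k ≤? len R₁
      ... | yes k≤l = inside R₁ k k≤l
      ... | no k≰l = inside R₂ (k ∸ len R₁) (subst (k ∸ len R₁ ≤_) (m+n∸m≡n (len R₁) (len R₂)) (∸-monoˡ-≤ (len R₁) k≤))

      concat : Route
      len concat = len R₁ + len R₂
      at concat = concatAt
      step concat = concat-stepwise Edge (step R₁) (step R₂)
      key-increasing concat = concat-stepwise (λ u v → key u < key v) (key-increasing R₁) (key-increasing R₂)
      inside concat = concat-inside

      concat-start : at concat 0 ≡ at R₁ 0
      concat-start = concatAt-first 0 z≤n

      concat-end : at concat (len concat) ≡ at R₂ (len R₂)
      concat-end = trans (concatAt-second (len R₁ + len R₂) (m≤m+n (len R₁) (len R₂)))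
                         (cong (at R₂) (m+n∸m≡n (len R₁) (len R₂)))

    key-strictly-increasing : (R : Route) → ∀ j k → j < k → k ≤ len R → key (at R j) < key (at R k)
    key-strictly-increasing R j (suc k) (s≤s j≤k) sk≤ with m≤n⇒m<n∨m≡n j≤k
    ... | inj₁ j<k = <-trans (key-strictly-increasing R j k j<k (<⇒≤ sk≤)) (key-increasing R k sk≤)
    ... | inj₂ refl = key-increasing R j sk≤

    route-injective : (R : Route) → ∀ j k → j ≤ len R → k ≤ len R → at R j ≡ at R k → j ≡ k
    route-injective R j k j≤ k≤ e with <-cmp j k
    ... | tri≈ _ j≡k _ = j≡k
    ... | tri< j<k _ _ = ⊥-elim (<-irrefl (cong key e) (key-strictly-increasing R j k j<k k≤))
    ... | tri> _ _ k<j = ⊥-elim (<-irrefl (cong key (sym e)) (key-strictly-increasing R k j k<j j≤))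

    toWalk : Route → Walk
    toWalk R = record { L = len R ; pt = at R ; pt-step = step R ; pt-injective = route-injective R }

  row≤top : ∀ i → i < R → m * i ≤ Ht
  row≤top i i<R = *-monoʳ-≤ m (<⇒≤ i<R)

  -- The detour through row i and the columns x₀, x₁ of index 2J, 2J + 1:
  -- along row i to x₀, up to the top, over the long edge and the unit edges
  -- to x₁, down to row i and along it to the right border.  Its key orders
  -- points by x and then by y, with y reversed on the column x₁, so that it
  -- strictly increases along the detour.
  module Detour (i J : ℕ) (i<R : i < R) (J<C : J + J < C') where
    J₂ x₀ x₁ : ℕ
    J₂ = J + J
    x₀ = a + m * J₂
    x₁ = a + m * suc J₂

    x₀+m : x₀ + m ≡ x₁
    x₀+m = column-step J₂ m refl

    x₀<x₁ : x₀ < x₁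
    x₀<x₁ = subst (x₀ <_) x₀+m (m<m+n x₀ 0<m)

    heightKey : ℕ → ℕ → ℕ
    heightKey x y with x ≟ x₁
    ... | yes _ = Ht ∸ y
    ... | no _ = y

    heightKey≤ : ∀ x y → y ≤ Ht → heightKey x y ≤ Ht
    heightKey≤ x y y≤ with x ≟ x₁
    ... | yes _ = m∸n≤m Ht y
    ... | no _ = y≤

    key : Point → ℕ
    key (x , y) = suc Ht * x + heightKey x y

    key-right : ∀ x s y y' → 1 ≤ s → y ≤ Ht → y' ≤ Ht → key (x , y) < key (x + s , y')
    key-right x s y y' 1≤s y≤ y'≤ = begin-strict
        suc Ht * x + heightKey x y ≤⟨ +-monoʳ-≤ (suc Ht * x) (heightKey≤ x y y≤) ⟩
        suc Ht * x + Ht <⟨ +-monoʳ-< (suc Ht * x) (n<1+n Ht) ⟩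
        suc Ht * x + suc Ht ≡⟨ trans (+-comm (suc Ht * x) (suc Ht)) (sym (*-suc (suc Ht) x)) ⟩
        suc Ht * suc x ≤⟨ *-monoʳ-≤ (suc Ht) (subst (_≤ x + s) (+-comm x 1) (+-monoʳ-≤ x 1≤s)) ⟩
        suc Ht * (x + s) ≤⟨ m≤m+n _ _ ⟩
        suc Ht * (x + s) + heightKey (x + s) y' ∎
      where open ≤-Reasoning

    key-up : ∀ x y y' → x ≢ x₁ → y < y' → key (x , y) < key (x , y')
    key-up x y y' x≢ lt with x ≟ x₁
    ... | yes e = ⊥-elim (x≢ e)
    ... | no _ = +-monoʳ-< (suc Ht * x) lt

    key-down : ∀ y → suc y ≤ Ht → key (x₁ , suc y) < key (x₁ , y)
    key-down y le with x₁ ≟ x₁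
    ... | no ¬e = ⊥-elim (¬e refl)
    ... | yes _ = +-monoʳ-< (suc Ht * x₁) (∸-monoʳ-< (n<1+n y) le)

    InRowOrStrip : Point → Set
    InRowOrStrip v = (proj₂ v ≡ m * i) ⊎ ((x₀ ≤ proj₁ v) × (proj₁ v ≤ x₁))

    open Routes key InRowOrStrip
    open Route

    climb : ℕ
    climb = Ht ∸ m * i

    row+climb : m * i + climb ≡ Ht
    row+climb = m+[n∸m]≡n (row≤top i i<R)

    x₁≤W : x₁ ≤ W
    x₁≤W = <⇒≤ (column<W (suc J₂) J<C)

    alongRow : Route
    len alongRow = x₀
    at alongRow t = (t , m * i)
    step alongRow t t< = inj₁ (row-arc i t i<R (<-trans t< (column<W J₂ (<⇒≤ J<C))) refl refl)
    key-increasing alongRow t t< = subst (λ z → key (t , m * i) < key (z , m * i)) (+-comm t 1) (key-right t 1 (m * i) (m * i) ≤-refl (row≤top i i<R) (row≤top i i<R))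
    inside alongRow t _ = inj₁ refl

    upColumn : Route
    len upColumn = climb
    at upColumn t = (x₀ , m * i + t)
    step upColumn t t< = inj₁ (column-arc J₂ (m * i + t) (<⇒≤ J<C) (subst (m * i + t <_) row+climb (+-monoʳ-< (m * i) t<)) refl
                     (cong (x₀ ,_) (+-suc (m * i) t)))
    key-increasing upColumn t t< = key-up x₀ (m * i + t) (m * i + suc t) (λ e → <-irrefl e x₀<x₁) (+-monoʳ-< (m * i) (n<1+n t))
    inside upColumn t _ = inj₂ (≤-refl , <⇒≤ x₀<x₁)

    longEdgeAt : ℕ → Point
    longEdgeAt zero = (x₀ , Ht)
    longEdgeAt (suc _) = (x₀ + suc h0 , Ht)

    longEdge : Route
    len longEdge = 1
    at longEdge = longEdgeAt
    step longEdge zero _ = inj₁ (long-arc J₂ J<C refl refl)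
    step longEdge (suc k) (s≤s ())
    key-increasing longEdge zero _ = key-right x₀ (suc h0) Ht Ht (s≤s z≤n) ≤-refl ≤-refl
    key-increasing longEdge (suc k) (s≤s ())
    inside longEdge zero _ = inj₂ (≤-refl , <⇒≤ x₀<x₁)
    inside longEdge (suc _) _ = inj₂ (m≤m+n x₀ (suc h0) , subst (x₀ + suc h0 ≤_) x₀+m (+-monoʳ-≤ x₀ h0<m))

    acrossTopLen : ℕ
    acrossTopLen = m ∸ suc h0

    acrossTop : Route
    len acrossTop = acrossTopLen
    at acrossTop t = (x₀ + (suc h0 + t) , Ht)
    step acrossTop t t< = inj₁ (top-arc J₂ (suc h0 + t) J<C (s≤s (m≤m+n h0 t))
                     (subst (suc h0 + t <_) (m+[n∸m]≡n h0<m) (+-monoʳ-< (suc h0) t<)) refl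
                     (cong (λ z → (x₀ + z , Ht)) (+-suc (suc h0) t)))
    key-increasing acrossTop t t< = subst (λ z → key (x₀ + (suc h0 + t) , Ht) < key (z , Ht))
                     (trans (+-assoc x₀ (suc h0 + t) 1) (cong (x₀ +_) (trans (+-assoc (suc h0) t 1) (cong (suc h0 +_) (+-comm t 1)))))
                     (key-right (x₀ + (suc h0 + t)) 1 Ht Ht ≤-refl ≤-refl ≤-refl)
    inside acrossTop t t≤ = inj₂ (m≤m+n x₀ _ , subst (x₀ + (suc h0 + t) ≤_) x₀+m
                     (+-monoʳ-≤ x₀ (subst (suc h0 + t ≤_) (m+[n∸m]≡n h0<m) (+-monoʳ-≤ (suc h0) t≤))))

    downColumn : Route
    len downColumn = climb
    at downColumn t = (x₁ , m * i + (climb ∸ t))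
    step downColumn t t< = inj₂ (column-arc (suc J₂) (m * i + (climb ∸ suc t)) J<C
                     (subst (m * i + (climb ∸ suc t) <_) row+climb (+-monoʳ-< (m * i) (∸-monoʳ-< z<s t<)))
                     refl (cong (x₁ ,_) (trans (cong (m * i +_) (+-∸-assoc 1 t<)) (+-suc (m * i) (climb ∸ suc t)))))
    key-increasing downColumn t t< = subst (λ z → key (x₁ , z) < key (x₁ , m * i + (climb ∸ suc t)))
                     (trans (sym (+-suc (m * i) (climb ∸ suc t))) (cong (m * i +_) (sym (+-∸-assoc 1 t<))))
                     (key-down (m * i + (climb ∸ suc t)) (subst (_≤ Ht) (+-suc (m * i) (climb ∸ suc t))
                        (subst (m * i + suc (climb ∸ suc t) ≤_) row+climb (+-monoʳ-≤ (m * i) (subst (_≤ climb) (+-∸-assoc 1 t<) (m∸n≤m climb t))))))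
    inside downColumn t _ = inj₂ (<⇒≤ x₀<x₁ , ≤-refl)

    toRightBorder : Route
    len toRightBorder = W ∸ x₁
    at toRightBorder t = (x₁ + t , m * i)
    step toRightBorder t t< = inj₁ (row-arc i (x₁ + t) i<R (subst (x₁ + t <_) (m+[n∸m]≡n x₁≤W) (+-monoʳ-< x₁ t<)) refl
                     (cong (_, m * i) (+-suc x₁ t)))
    key-increasing toRightBorder t t< = subst (λ z → key (x₁ + t , m * i) < key (z , m * i)) (trans (+-assoc x₁ t 1) (cong (x₁ +_) (+-comm t 1)))
                     (key-right (x₁ + t) 1 (m * i) (m * i) ≤-refl (row≤top i i<R) (row≤top i i<R))
    inside toRightBorder t _ = inj₁ refl

    join₅₆ : at downColumn climb ≡ at toRightBorder 0
    join₅₆ = cong₂ _,_ (sym (+-identityʳ x₁)) (trans (cong (m * i +_) (n∸n≡0 climb)) (+-identityʳ (m * i)))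
    fromDescent : Route
    fromDescent = Concat.concat downColumn toRightBorder join₅₆

    join₄₅ : at acrossTop acrossTopLen ≡ at fromDescent 0
    join₄₅ = trans (cong₂ _,_ (trans (cong (x₀ +_) (trans (+-comm (suc h0) acrossTopLen) (m∸n+n≡m h0<m))) x₀+m) (sym row+climb))
                   (sym (Concat.concat-start downColumn toRightBorder join₅₆))
    fromAcross : Route
    fromAcross = Concat.concat acrossTop fromDescent join₄₅

    join₃₄ : at longEdge 1 ≡ at fromAcross 0
    join₃₄ = trans (cong (λ z → (x₀ + z , Ht)) (sym (+-identityʳ (suc h0)))) (sym (Concat.concat-start acrossTop fromDescent join₄₅))
    fromLongEdge : Route
    fromLongEdge = Concat.concat longEdge fromAcross join₃₄

    join₂₃ : at upColumn climb ≡ at fromLongEdge 0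
    join₂₃ = trans (cong (x₀ ,_) row+climb) (sym (Concat.concat-start longEdge fromAcross join₃₄))
    fromClimb : Route
    fromClimb = Concat.concat upColumn fromLongEdge join₂₃

    join₁₂ : at alongRow x₀ ≡ at fromClimb 0
    join₁₂ = trans (cong (x₀ ,_) (sym (+-identityʳ (m * i)))) (sym (Concat.concat-start upColumn fromLongEdge join₂₃))
    detour : Route
    detour = Concat.concat alongRow fromClimb join₁₂

    detourWalk : Walk
    detourWalk = toWalk detour

    detour-start : at detour 0 ≡ (0 , m * i)
    detour-start = Concat.concat-start alongRow fromClimb join₁₂

    detour-end : at detour (len detour) ≡ (W , m * i)
    detour-end = trans (Concat.concat-end alongRow fromClimb join₁₂) (trans (Concat.concat-end upColumn fromLongEdge join₂₃) (trans (Concat.concat-end longEdge fromAcross join₃₄)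
            (trans (Concat.concat-end acrossTop fromDescent join₄₅) (trans (Concat.concat-end downColumn toRightBorder join₅₆) (cong (_, m * i) (m+[n∸m]≡n x₁≤W))))))

    detour-inside : ∀ k → k ≤ len detour → InRowOrStrip (at detour k)
    detour-inside = inside detour

    climb≡ : climb ≡ m * (R ∸ i)
    climb≡ = sym (*-distribˡ-∸ m R i)

    W∸x₁≡ : W ∸ x₁ ≡ m * (C' ∸ suc J₂) + b
    W∸x₁≡ = begin
        (a + m * C' + b) ∸ (a + m * suc J₂) ≡⟨ cong (_∸ (a + m * suc J₂)) (+-assoc a (m * C') b) ⟩
        (a + (m * C' + b)) ∸ (a + m * suc J₂) ≡⟨ [m+n]∸[m+o]≡n∸o a (m * C' + b) (m * suc J₂) ⟩
        (m * C' + b) ∸ m * suc J₂ ≡⟨ cong (_∸ m * suc J₂) (+-comm (m * C') b) ⟩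
        (b + m * C') ∸ m * suc J₂ ≡⟨ +-∸-assoc b (*-monoʳ-≤ m J<C) ⟩
        b + (m * C' ∸ m * suc J₂) ≡⟨ cong (b +_) (sym (*-distribˡ-∸ m C' (suc J₂))) ⟩
        b + m * (C' ∸ suc J₂) ≡⟨ +-comm b _ ⟩
        m * (C' ∸ suc J₂) + b ∎
      where open ≡-Reasoning

    detour-length : len detour + h0 ≡ (a + b) + m * (J₂ + (R ∸ i) + (R ∸ i) + (C' ∸ suc J₂) + 1)
    detour-length rewrite climb≡ | W∸x₁≡ = identity a b m h0 J₂ (R ∸ i) (C' ∸ suc J₂) acrossTopLen (m∸n+n≡m h0<m)
      where
      open import Data.Nat.Tactic.RingSolver renaming (solve-∀ to ℕ-solve-∀)
      identity₁ : ∀ a b m h0 J₂ E G T → (a + m * J₂ + (m * E + (1 + (T + (m * E + (m * G + b)))))) + h0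
                                       ≡ (a + b + m * (J₂ + E + E + G)) + (T + suc h0)
      identity₁ = ℕ-solve-∀
      identity₂ : ∀ a b m J₂ E G → (a + b + m * (J₂ + E + E + G)) + m ≡ (a + b) + m * (J₂ + E + E + G + 1)
      identity₂ = ℕ-solve-∀
      identity : ∀ a b m h0 J₂ E G T → T + suc h0 ≡ m →
        (a + m * J₂ + (m * E + (1 + (T + (m * E + (m * G + b)))))) + h0 ≡ (a + b) + m * (J₂ + E + E + G + 1)
      identity a b m h0 J₂ E G T e =
        trans (identity₁ a b m h0 J₂ E G T) (trans (cong (a + b + m * (J₂ + E + E + G) +_) e) (identity₂ a b m J₂ E G))

    detour-length≡d : (d : ℕ) → ι (a + b) ≡ ι (d + h0) mod m → ι (len detour) ≡ ι d mod m
    detour-length≡d d a+b≡d+h0 = mod-cancelʳ {u = ι (len detour)} {w = ι h0} (mod-trans length+h0≡a+b (mod-trans a+b≡d+h0 (mod-reflexive (pos-+ d h0))))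
      where
      K : ℕ
      K = J₂ + (R ∸ i) + (R ∸ i) + (C' ∸ suc J₂) + 1
      length+h0≡a+b : ι (len detour) +ℤ ι h0 ≡ ι (a + b) mod m
      length+h0≡a+b = ι K , trans (sym (pos-+ (len detour) h0)) (trans (cong ι detour-length)
                        (trans (pos-+ (a + b) (m * K)) (cong (ι (a + b) +ℤ_) (trans (pos-* m K) (ℤP.*-comm (ι m) (ι K))))))

  arc-bounds : ∀ {p q} → Arc p q → ((proj₁ p ≤ W) × (proj₂ p ≤ Ht)) × ((proj₁ q ≤ W) × (proj₂ q ≤ Ht))
  arc-bounds (row-arc i x i<R x<W refl refl) = (<⇒≤ x<W , row≤top i i<R) , (x<W , row≤top i i<R)
  arc-bounds (column-arc j y j≤ y< refl refl) = (<⇒≤ (column<W j j≤) , <⇒≤ y<) , (<⇒≤ (column<W j j≤) , y<)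
  arc-bounds (top-arc j t j< _ t<m refl refl) = (<⇒≤ (top<W j t j< (<⇒≤ t<m)) , ≤-refl) , (<⇒≤ (top<W j (suc t) j< t<m) , ≤-refl)
  arc-bounds (long-arc j j< refl refl) = (<⇒≤ (column<W j (<⇒≤ j<)) , ≤-refl) , (<⇒≤ (top<W j (suc h0) j< h0<m) , ≤-refl)

  Edge-bounds : ∀ {p q} → Edge p q → (proj₁ p ≤ W) × (proj₂ p ≤ Ht)
  Edge-bounds (inj₁ e) = proj₁ (arc-bounds e)
  Edge-bounds (inj₂ e) = proj₂ (arc-bounds e)

  arc-irrefl : ∀ {p} → Arc p p → ⊥
  arc-irrefl e with direction e
  ... | rightward s 1≤s _ ex _ = <-irrefl ex (m<m+n _ 1≤s)
  ... | upward _ ey _ = <-irrefl ey (n<1+n _)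

  Edge-irrefl : ∀ {p} → Edge p p → ⊥
  Edge-irrefl (inj₁ e) = arc-irrefl e
  Edge-irrefl (inj₂ e) = arc-irrefl e

  module _ (P : Walk) where
    open Walk P

    -- Terminals have degree one, so a walk cannot pass through one.
    interior-not-terminal : ∀ k → 0 < k → k < L → ¬ Terminal (pt k)
    interior-not-terminal (suc k) _ sk<L isA = <-irrefl (pt-injective k (suc (suc k)) (<⇒≤ (<-trans (n<1+n k) sk<L)) sk<L (e isA)) (<-trans (n<1+n k) (n<1+n (suc k)))
      where
      e1 : Edge (pt (suc k)) (pt k)
      e1 = Edge-sym (pt-step k (<-trans (n<1+n k) sk<L))
      e2 : Edge (pt (suc k)) (pt (suc (suc k)))
      e2 = pt-step (suc k) sk<L
      e : Terminal (pt (suc k)) → pt k ≡ pt (suc (suc k))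
      e (inj₁ (i , _ , eq)) = trans (left-terminal-neighbour (subst (λ z → Edge z (pt k)) eq e1)) (sym (left-terminal-neighbour (subst (λ z → Edge z (pt (suc (suc k)))) eq e2)))
      e (inj₂ (i , _ , eq)) = trans (right-terminal-neighbour (subst (λ z → Edge z (pt k)) eq e1)) (sym (right-terminal-neighbour (subst (λ z → Edge z (pt (suc (suc k)))) eq e2)))

    reverse : Walk
    reverse = record
      { L = L
      ; pt = λ k → pt (L ∸ k)
      ; pt-step = λ k k< → subst (λ z → Edge (pt z) (pt (L ∸ suc k))) (sym (+-∸-assoc 1 k<))
                         (Edge-sym (pt-step (L ∸ suc k) (<-≤-trans (subst (L ∸ suc k <_) (sym (+-∸-assoc 1 k<)) ≤-refl) (m∸n≤m L k))))
      ; pt-injective = λ j k j≤ k≤ e → ∸-cancelˡ-≡ j≤ k≤ (pt-injective (L ∸ j) (L ∸ k) (m∸n≤m L j) (m∸n≤m L k) e)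
      }

  long-edge-interior-offset : ∀ j j′ t t′ → 1 ≤ t → t ≤ h0 → a + m * j + t ≡ a + m * j′ + t′ → t′ ≤ m →
    (h0 < t′) ⊎ (t′ ≡ 0) → ⊥
  long-edge-interior-offset j j′ t t′ 1≤t t≤h0 e t′≤m t′-far with m≤n⇒m<n∨m≡n t′≤m
  ... | inj₁ t′<m with offset-quotRem-unique a m j j′ t t′ e (≤-<-trans t≤h0 h0<m) t′<m | t′-far
  ...   | _ , refl | inj₁ h0<t = <-irrefl refl (<-≤-trans h0<t t≤h0)
  ...   | _ , refl | inj₂ refl = <-irrefl refl 1≤t
  long-edge-interior-offset j j′ t t′ 1≤t t≤h0 e t′≤m t′-far | inj₂ t′≡m
    with offset-quotRem-unique a m j (suc j′) t 0 (trans e (trans (column-step j′ t′ t′≡m) (sym (+-identityʳ _))))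
           (≤-<-trans t≤h0 h0<m) 0<m
  ... | _ , refl = <-irrefl refl 1≤t

  long-edge-interior-isolated : ∀ j t → 1 ≤ t → t ≤ h0 → ∀ s → ¬ Edge (a + m * j + t , m * R) s
  long-edge-interior-isolated j t 1≤t t≤h0 s = no-edge
    where
    clash : ∀ {j′ t′} → a + m * j + t ≡ a + m * j′ + t′ → t′ ≤ m → (h0 < t′) ⊎ (t′ ≡ 0) → ⊥
    clash {j′} {t′} = long-edge-interior-offset j j′ t t′ 1≤t t≤h0
    at-column : ∀ {j′} → a + m * j + t ≡ a + m * j′ → ⊥
    at-column e = clash (trans e (sym (+-identityʳ _))) z≤n (inj₂ refl)
    no-edge : ¬ Edge (a + m * j + t , m * R) s
    no-edge (inj₁ (row-arc i _ i<R _ e _)) = row≢top i i<R (sym (cong proj₂ e))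
    no-edge (inj₁ (column-arc _ _ _ _ e _)) = at-column (cong proj₁ e)
    no-edge (inj₁ (top-arc _ _ _ h0<t′ t′<m e _)) = clash (cong proj₁ e) (<⇒≤ t′<m) (inj₁ h0<t′)
    no-edge (inj₁ (long-arc _ _ e _)) = at-column (cong proj₁ e)
    no-edge (inj₂ (row-arc i _ i<R _ _ e)) = row≢top i i<R (sym (cong proj₂ e))
    no-edge (inj₂ (column-arc _ _ _ _ _ e)) = at-column (cong proj₁ e)
    no-edge (inj₂ (top-arc _ t′ _ h0<t′ t′<m _ e)) = clash (cong proj₁ e) t′<m (inj₁ (<-trans h0<t′ (n<1+n t′)))
    no-edge (inj₂ (long-arc _ _ _ e)) = clash (cong proj₁ e) h0<m (inj₁ (n<1+n h0))

  open Crossing.PlaneGraph Edge Edge-sym using (Isolated; Shape; up; down; horizontal)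

  ¬between-suc : ∀ z x → ¬ Between z x (suc x)
  ¬between-suc z x (between< x<z z<sx) = <-irrefl refl (<-≤-trans x<z (≤-pred z<sx))
  ¬between-suc z x (between> sx<z z<x) = <-asym z<x (<-trans (n<1+n x) sx<z)

  ¬between-suc⁻ : ∀ z x → ¬ Between z (suc x) x
  ¬between-suc⁻ z x (between< sx<z z<x) = <-asym z<x (<-trans (n<1+n x) sx<z)
  ¬between-suc⁻ z x (between> x<z z<sx) = <-irrefl refl (<-≤-trans x<z (≤-pred z<sx))

  between-long-edge : ∀ x z → Between z x (x + suc h0) ⊎ Between z (x + suc h0) x → (x < z) × (z < x + suc h0)
  between-long-edge x z (inj₁ (between< p q)) = p , q
  between-long-edge x z (inj₁ (between> p q)) = ⊥-elim (<-asym p (<-trans q (m<m+n x (s≤s z≤n))))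
  between-long-edge x z (inj₂ (between< p q)) = ⊥-elim (<-asym q (<-trans (m<m+n x (s≤s z≤n)) p))
  between-long-edge x z (inj₂ (between> p q)) = p , q

  under-long-edge-isolated : ∀ j z → Between z (a + m * j) (a + m * j + suc h0) ⊎ Between z (a + m * j + suc h0) (a + m * j) →
    Isolated (z , m * R)
  under-long-edge-isolated j z bt s e = long-edge-interior-isolated j (z ∸ x) (m<n⇒0<n∸m x<z) z∸x≤h0 s
    (subst (λ w → Edge (w , m * R) s) (sym (m+[n∸m]≡n (<⇒≤ x<z))) e)
    where
    x : ℕ
    x = a + m * j
    x<z : x < z
    x<z = proj₁ (between-long-edge x z bt)
    z∸x≤h0 : z ∸ x ≤ h0
    z∸x≤h0 = ≤-pred (subst (z ∸ x <_) (m+n∸m≡n x (suc h0)) (∸-monoˡ-< (proj₂ (between-long-edge x z bt)) (<⇒≤ x<z)))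

  shape : ∀ {p q} → Edge p q → Shape p q
  shape (inj₁ (row-arc i x _ _ refl refl)) = horizontal refl (λ e → <-irrefl e (n<1+n x)) (λ z bt → ⊥-elim (¬between-suc z x bt))
  shape (inj₁ (column-arc j y _ _ refl refl)) = up refl refl
  shape (inj₁ (top-arc j t _ _ _ refl refl)) = horizontal refl (λ e → <-irrefl (trans e (+-suc _ t)) (n<1+n _))
      (λ z bt → ⊥-elim (¬between-suc z (a + m * j + t) (subst (Between z (a + m * j + t)) (+-suc _ t) bt)))
  shape (inj₁ (long-arc j _ refl refl)) = horizontal refl (λ e → <-irrefl e (m<m+n _ (s≤s z≤n)))
      (λ z bt → under-long-edge-isolated j z (inj₁ bt))
  shape (inj₂ (row-arc i x _ _ refl refl)) = horizontal refl (λ e → <-irrefl (sym e) (n<1+n x)) (λ z bt → ⊥-elim (¬between-suc⁻ z x bt))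
  shape (inj₂ (column-arc j y _ _ refl refl)) = down refl refl
  shape (inj₂ (top-arc j t _ _ _ refl refl)) = horizontal refl (λ e → <-irrefl (sym (trans (sym (+-suc (a + m * j) t)) e)) (n<1+n _))
      (λ z bt → ⊥-elim (¬between-suc⁻ z (a + m * j + t) (subst (λ w → Between z w (a + m * j + t)) (+-suc _ t) bt)))
  shape (inj₂ (long-arc j _ refl refl)) = horizontal refl (λ e → <-irrefl (sym e) (m<m+n _ (s≤s z≤n)))
      (λ z bt → under-long-edge-isolated j z (inj₂ bt))

  record Traversal (Q : Walk) : Set where
    field
      len          : ℕ
      at           : ℕ → Point
      step         : ∀ k → k < len → Edge (at k) (at (suc k))
      1≤len        : 1 ≤ len
      starts-left  : LeftTerminal (at 0)
      ends-right   : RightTerminal (at len)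
      reaches-top  : Σ ℕ λ t → t ≤ len × proj₂ (at t) ≡ Ht
      within       : ∀ k → k ≤ len → Σ ℕ λ k′ → k′ ≤ Walk.L Q × at k ≡ Walk.pt Q k′

  traversal : (Q : Walk) → 1 ≤ Walk.L Q → LeftRightViaTop Q → Traversal Q
  traversal Q 1≤L (inj₁ (l0 , rL) , (t , t< , top)) = record
    { len = Walk.L Q ; at = Walk.pt Q ; step = Walk.pt-step Q ; 1≤len = 1≤L ; starts-left = l0 ; ends-right = rL
    ; reaches-top = t , <⇒≤ t< , top ; within = λ k k≤ → k , k≤ , refl }
  traversal Q 1≤L (inj₂ (r0 , lL) , (t , t< , top)) = record
    { len = Walk.L Q ; at = Walk.pt (reverse Q) ; step = Walk.pt-step (reverse Q) ; 1≤len = 1≤L ; starts-left = lL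
    ; ends-right = subst (λ z → RightTerminal (Walk.pt Q z)) (sym (n∸n≡0 (Walk.L Q))) r0
    ; reaches-top = Walk.L Q ∸ t , m∸n≤m _ t , subst (λ z → proj₂ (Walk.pt Q z) ≡ Ht) (sym (m∸[m∸n]≡n (<⇒≤ t<))) top
    ; within = λ k k≤ → Walk.L Q ∸ k , m∸n≤m _ k , refl }

  WithinGrid : Walk → Set
  WithinGrid Q = ∀ k → k ≤ Walk.L Q → (proj₁ (Walk.pt Q k) ≤ W) × (proj₂ (Walk.pt Q k) ≤ Ht)

  WalksDisjoint : Walk → Walk → Set
  WalksDisjoint Q₁ Q₂ = ∀ j k → j ≤ Walk.L Q₁ → k ≤ Walk.L Q₂ → Walk.pt Q₁ j ≢ Walk.pt Q₂ k

  lower-traversal-blocked : (Q₁ Q₂ : Walk) (T₁ : Traversal Q₁) (T₂ : Traversal Q₂) → WalksDisjoint Q₁ Q₂ →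
    WithinGrid Q₁ → WithinGrid Q₂ → proj₂ (Traversal.at T₂ 0) < proj₂ (Traversal.at T₁ 0) → ⊥
  lower-traversal-blocked Q₁ Q₂ T₁ T₂ disjoint grid₁ grid₂ lower =
    Separation.cannot-reach-top shape W Ht (len T₁) (at T₁) (step T₁) (1≤len T₁)
      (λ k k≤ → proj₂ (bounded T₁ grid₁ k k≤)) (cong proj₁ (proj₂ (proj₂ (starts-left T₁))))
      (cong proj₁ (proj₂ (proj₂ (ends-right T₁)))) 1≤W
      (len T₂) (at T₂) (step T₂) (λ k k≤ → proj₁ (bounded T₂ grid₂ k k≤)) traversals-disjoint
      (cong proj₁ (proj₂ (proj₂ (starts-left T₂)))) lower (proj₁ (reaches-top T₂)) (proj₁ (proj₂ (reaches-top T₂)))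
      (proj₂ (proj₂ (reaches-top T₂)))
    where
    open Traversal
    open Crossing.PlaneGraph Edge Edge-sym using (module Separation)
    bounded : ∀ {Q} (T : Traversal Q) → WithinGrid Q → ∀ k → k ≤ len T → (proj₁ (at T k) ≤ W) × (proj₂ (at T k) ≤ Ht)
    bounded T grid k k≤ with within T k k≤
    ... | k′ , k′≤ , e rewrite e = grid k′ k′≤
    traversals-disjoint : ∀ k j → k ≤ len T₂ → j ≤ len T₁ → at T₁ j ≢ at T₂ k
    traversals-disjoint k j k≤ j≤ e with within T₁ j j≤ | within T₂ k k≤
    ... | j′ , j′≤ , e₁ | k′ , k′≤ , e₂ = disjoint j′ k′ j′≤ k′≤ (trans (sym e₁) (trans e e₂))

  traversals-meet : (Q₁ Q₂ : Walk) → Traversal Q₁ → Traversal Q₂ → WalksDisjoint Q₁ Q₂ →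
    WithinGrid Q₁ → WithinGrid Q₂ → ⊥
  traversals-meet Q₁ Q₂ T₁ T₂ disjoint grid₁ grid₂ with <-cmp (proj₂ (Traversal.at T₁ 0)) (proj₂ (Traversal.at T₂ 0))
  ... | tri< lt _ _ = lower-traversal-blocked Q₂ Q₁ T₂ T₁ (λ j k j≤ k≤ e → disjoint k j k≤ j≤ (sym e)) grid₂ grid₁ lt
  ... | tri> _ _ gt = lower-traversal-blocked Q₁ Q₂ T₁ T₂ disjoint grid₁ grid₂ gt
  ... | tri≈ _ same-height _ with Traversal.within T₁ 0 z≤n | Traversal.within T₂ 0 z≤n
  ...   | j′ , j′≤ , e₁ | k′ , k′≤ , e₂ = disjoint j′ k′ j′≤ k′≤ (trans (sym e₁) (trans same-start e₂))
    where
    same-start : Traversal.at T₁ 0 ≡ Traversal.at T₂ 0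
    same-start = cong₂ _,_ (trans (cong proj₁ (proj₂ (proj₂ (Traversal.starts-left T₁))))
                               (sym (cong proj₁ (proj₂ (proj₂ (Traversal.starts-left T₂)))))) same-height

module Pigeonhole where

  open import Data.Nat
  open import Data.Nat.Properties
  open import Data.Fin using (Fin)
  open import Data.Fin.Subset using (Subset; _∈_; ∣_∣; _─_; _∩_)
  open import Data.Fin.Subset.Properties using (nonempty?; p∩q≢∅⇒∣p─q∣<∣p∣; x∈p∧x∉q⇒x∈p─q; x∈p∩q⁺)
  open import Data.Vec using (tabulate)
  open import Data.Vec.Properties using (lookup∘tabulate; []=⇒lookup; lookup⇒[]=)
  open import Data.Product using (Σ; _×_; _,_)
  open import Relation.Nullary using (¬_; Dec; yes; no; does)
  open import Relation.Nullary.Decidable using (dec-true)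
  open import Relation.Binary.PropositionalEquality

  toSubset : ∀ {n} (S : Fin n → Set) → (∀ v → Dec (S v)) → Subset n
  toSubset S S? = tabulate (λ v → does (S? v))

  ∈-toSubset⁺ : ∀ {n} (S : Fin n → Set) (S? : ∀ v → Dec (S v)) v → S v → v ∈ toSubset S S?
  ∈-toSubset⁺ S S? v s = lookup⇒[]= v _ (trans (lookup∘tabulate (λ v → does (S? v)) v) (dec-true (S? v) s))

  ∈-toSubset⁻ : ∀ {n} (S : Fin n → Set) (S? : ∀ v → Dec (S v)) v → v ∈ toSubset S S? → S v
  ∈-toSubset⁻ S S? v i with S? v | trans (sym (lookup∘tabulate (λ v → does (S? v)) v)) ([]=⇒lookup i)
  ... | yes s | _ = s
  ... | no _ | ()

  avoided-class : ∀ {n} (S : ℕ → Fin n → Set) (S? : ∀ j v → Dec (S j v))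
    (disjoint : ∀ j j' v → S j v → S j' v → j ≡ j') →
    ∀ K (X : Subset n) → ∣ X ∣ < K → Σ ℕ λ j → j < K × (∀ v → v ∈ X → ¬ S j v)
  avoided-class S S? disjoint zero X ()
  avoided-class S S? disjoint (suc K) X lt with nonempty? (X ∩ toSubset (S K) (S? K))
  ... | no ne = K , ≤-refl , λ v v∈X s → ne (v , x∈p∩q⁺ (v∈X , ∈-toSubset⁺ (S K) (S? K) v s))
  ... | yes ne with avoided-class S S? disjoint K (X ─ toSubset (S K) (S? K))
        (<-≤-trans (p∩q≢∅⇒∣p─q∣<∣p∣ X (toSubset (S K) (S? K)) ne) (≤-pred lt))
  ... | j , j<K , free = j , <-trans j<K (n<1+n K) , avoids
    where
    avoids : ∀ v → v ∈ X → ¬ S j v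
    avoids v v∈X s with S? K v
    ... | yes sK = <-irrefl (disjoint j K v s sK) j<K
    ... | no ¬sK = free v (x∈p∧x∉q⇒x∈p─q v∈X (λ i → ¬sK (∈-toSubset⁻ (S K) (S? K) v i))) s

open import Data.Nat using (_+_; _*_)
open import Data.Integer using () renaming (+_ to ι)
open import Relation.Binary.PropositionalEquality using (_≡_)
open Congruence using (_≡_mod_)

module Counterexample (m h0 a b d r N : ℕ) (h0<m : h0 < m) (0<h0 : 0 < h0) (1≤a : 1 ≤ a) (1≤b : 1 ≤ b)
  (a+b≡d+h0 : ι (a + b) ≡ ι (d + h0) mod m) (d≢2a : ¬ (ι d ≡ ι (a + a) mod h0)) (d≢2b : ¬ (ι d ≡ ι (b + b) mod h0))
  (m≡r*h0 : m ≡ r * h0) where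

  open import Data.Nat
  open import Data.Nat.Properties
  open import Data.Fin using (Fin; zero; suc; toℕ; fromℕ<; fromℕ; inject₁; combine; remQuot)
  open import Data.Fin.Properties using (toℕ-injective; toℕ<n; toℕ-fromℕ<; toℕ-inject₁; toℕ-fromℕ; remQuot-combine; combine-remQuot)
  open import Data.Fin.Subset using (Subset; _∈_; ∣_∣)
  open import Data.Product using (_×_; _,_; proj₁; proj₂; uncurry)
  open import Data.Sum using (inj₁; inj₂)
  open import Data.Empty using (⊥; ⊥-elim)
  open import Relation.Nullary using (¬_; _×-dec_)
  open import Relation.Binary.PropositionalEquality
  open import Relation.Binary.Definitions using (tri<; tri≈; tri>)
  open Crossing using (Point)
  open Congruence
  open Pigeonhole

  -- N + 1 rows and N + 1 disjoint column pairs (2J, 2J + 1), so that a set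
  -- of N vertices misses a row and a column pair.
  R C' : ℕ
  R = suc N
  C' = suc (suc (N + N))

  open Grid m h0 a b R C' h0<m 0<h0 1≤a 1≤b
  open Classify d a+b≡d+h0 d≢2a d≢2b r m≡r*h0

  n : ℕ
  n = suc Ht * suc W

  decode : Fin n → Point
  decode v = toℕ (proj₂ (remQuot {suc Ht} (suc W) v)) , toℕ (proj₁ (remQuot {suc Ht} (suc W) v))

  decode-bounds : ∀ v → (proj₁ (decode v) ≤ W) × (proj₂ (decode v) ≤ Ht)
  decode-bounds v = ≤-pred (toℕ<n _) , ≤-pred (toℕ<n _)

  encode : ∀ x y → x ≤ W → y ≤ Ht → Fin n
  encode x y x≤ y≤ = combine (fromℕ< (s≤s y≤)) (fromℕ< (s≤s x≤))

  decode-encode : ∀ x y x≤ y≤ → decode (encode x y x≤ y≤) ≡ (x , y)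
  decode-encode x y x≤ y≤ =
    trans (cong (λ p → toℕ (proj₂ p) , toℕ (proj₁ p)) (remQuot-combine {suc Ht} {suc W} (fromℕ< (s≤s y≤)) (fromℕ< (s≤s x≤))))
          (cong₂ _,_ (toℕ-fromℕ< (s≤s x≤)) (toℕ-fromℕ< (s≤s y≤)))

  decode-injective : ∀ u v → decode u ≡ decode v → u ≡ v
  decode-injective u v e = trans (sym (combine-remQuot {suc Ht} (suc W) u))
    (trans (cong (uncurry combine) (cong₂ _,_ (toℕ-injective (cong proj₂ e)) (toℕ-injective (cong proj₁ e))))
           (combine-remQuot {suc Ht} (suc W) v))

  grid : Graph n
  grid = record { Adj = λ u v → Edge (decode u) (decode v) ; sym = Edge-sym ; irrefl = Edge-irrefl }

  terminals : Subset n
  terminals = toSubset (λ v → Terminal (decode v)) (λ v → terminal? (decode v))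

  ∈-terminals⁻ : ∀ v → v ∈ terminals → Terminal (decode v)
  ∈-terminals⁻ = ∈-toSubset⁻ (λ v → Terminal (decode v)) (λ v → terminal? (decode v))

  ∈-terminals⁺ : ∀ v → Terminal (decode v) → v ∈ terminals
  ∈-terminals⁺ = ∈-toSubset⁺ (λ v → Terminal (decode v)) (λ v → terminal? (decode v))

  -- A path of the graph, read as a walk of grid points indexed by ℕ
  -- (saturating at the last vertex), and back.
  clamp : (L k : ℕ) → Fin (suc L)
  clamp L zero = zero
  clamp zero (suc k) = zero
  clamp (suc L) (suc k) = suc (clamp L k)

  clamp-toℕ : ∀ L (i : Fin (suc L)) → clamp L (toℕ i) ≡ i
  clamp-toℕ L zero = refl
  clamp-toℕ (suc L) (suc i) = cong suc (clamp-toℕ L i)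

  toℕ-clamp : ∀ L k → k ≤ L → toℕ (clamp L k) ≡ k
  toℕ-clamp L zero _ = refl
  toℕ-clamp (suc L) (suc k) (s≤s k≤) = cong suc (toℕ-clamp L k k≤)

  clamp-inject₁ : ∀ L k (k< : k < L) → clamp L k ≡ inject₁ (fromℕ< k<)
  clamp-inject₁ L k k< = trans (cong (clamp L) (sym (trans (toℕ-inject₁ (fromℕ< k<)) (toℕ-fromℕ< k<)))) (clamp-toℕ L _)

  clamp-suc : ∀ L k (k< : k < L) → clamp L (suc k) ≡ suc (fromℕ< k<)
  clamp-suc L k k< = trans (cong (clamp L) (sym (cong suc (toℕ-fromℕ< k<)))) (clamp-toℕ L (suc (fromℕ< k<)))

  clamp-last : ∀ L → clamp L L ≡ fromℕ L
  clamp-last L = trans (cong (clamp L) (sym (toℕ-fromℕ L))) (clamp-toℕ L (fromℕ L))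

  pathWalk : Path grid → Walk
  pathWalk P = record
    { L = len P
    ; pt = λ k → decode (vert P (clamp (len P) k))
    ; pt-step = λ k k< → subst₂ (λ u v → Edge (decode (vert P u)) (decode (vert P v)))
                           (sym (clamp-inject₁ (len P) k k<)) (sym (clamp-suc (len P) k k<)) (adj P (fromℕ< k<))
    ; pt-injective = λ j k j≤ k≤ e → trans (sym (toℕ-clamp (len P) j j≤))
                       (trans (cong toℕ (inj P (decode-injective (vert P (clamp (len P) j)) (vert P (clamp (len P) k)) e))) (toℕ-clamp (len P) k k≤))
    }

  pathWalk-withinGrid : ∀ P → WithinGrid (pathWalk P)
  pathWalk-withinGrid P k _ = decode-bounds (vert P (clamp (len P) k))

  walk-withinGrid : (Q : Walk) → 1 ≤ Walk.L Q → WithinGrid Q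
  walk-withinGrid Q 1≤L k k≤ with m≤n⇒m<n∨m≡n k≤
  ... | inj₁ k< = Edge-bounds (Walk.pt-step Q k k<)
  ... | inj₂ refl = Edge-bounds (Edge-sym (subst (λ z → Edge (Walk.pt Q (Walk.L Q ∸ 1)) (Walk.pt Q z)) (m+[n∸m]≡n 1≤L)
                      (Walk.pt-step Q (Walk.L Q ∸ 1) (subst (Walk.L Q ∸ 1 <_) (m+[n∸m]≡n 1≤L) ≤-refl))))

  module _ (Q : Walk) (1≤L : 1 ≤ Walk.L Q) where

    walkVertex : Fin (suc (Walk.L Q)) → Fin n
    walkVertex i = encode (proj₁ (Walk.pt Q (toℕ i))) (proj₂ (Walk.pt Q (toℕ i)))
                     (proj₁ (walk-withinGrid Q 1≤L (toℕ i) (≤-pred (toℕ<n i))))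
                     (proj₂ (walk-withinGrid Q 1≤L (toℕ i) (≤-pred (toℕ<n i))))

    decode-walkVertex : ∀ i → decode (walkVertex i) ≡ Walk.pt Q (toℕ i)
    decode-walkVertex i = decode-encode (proj₁ (Walk.pt Q (toℕ i))) (proj₂ (Walk.pt Q (toℕ i)))
                            (proj₁ (walk-withinGrid Q 1≤L (toℕ i) (≤-pred (toℕ<n i))))
                            (proj₂ (walk-withinGrid Q 1≤L (toℕ i) (≤-pred (toℕ<n i))))

    walkPath : Path grid
    walkPath = record
      { len = Walk.L Q
      ; vert = walkVertex
      ; inj = λ {i} {j} e → toℕ-injective (Walk.pt-injective Q (toℕ i) (toℕ j) (≤-pred (toℕ<n i)) (≤-pred (toℕ<n j))
                (trans (sym (decode-walkVertex i)) (trans (cong decode e) (decode-walkVertex j))))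
      ; adj = λ i → subst₂ Edge (sym (trans (decode-walkVertex (inject₁ i)) (cong (Walk.pt Q) (toℕ-inject₁ i))))
                      (sym (decode-walkVertex (suc i))) (Walk.pt-step Q (toℕ i) (toℕ<n i))
      }

  modAPath-traversal : (P : Path grid) → ModAPath grid terminals m d P → Traversal (pathWalk P)
  modAPath-traversal P (aPath , length≡d) = traversal (pathWalk P) 1≤L
    (classify (pathWalk P) 1≤L (∈-terminals⁻ (vert P zero) (IsAPath.startIn aPath))
      (subst (λ z → Terminal (decode (vert P z))) (sym (clamp-last (len P))) (∈-terminals⁻ (vert P (fromℕ (len P))) (IsAPath.endIn aPath)))
      (%≡⇒mod m (len P) d length≡d))
    where
    1≤L : 1 ≤ len P
    1≤L = IsAPath.nonTrivial aPath

  no-two-disjoint-modAPaths : (P₁ P₂ : Path grid) → ModAPath grid terminals m d P₁ → ModAPath grid terminals m d P₂ →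
    Disjoint P₁ P₂ → ⊥
  no-two-disjoint-modAPaths P₁ P₂ mp₁ mp₂ disjoint =
    traversals-meet (pathWalk P₁) (pathWalk P₂) (modAPath-traversal P₁ mp₁) (modAPath-traversal P₂ mp₂)
      (λ j k _ _ e → disjoint (clamp (len P₁) j) (clamp (len P₂) k) (decode-injective (vert P₁ (clamp (len P₁) j)) (vert P₂ (clamp (len P₂) k)) e))
      (pathWalk-withinGrid P₁) (pathWalk-withinGrid P₂)

  OnRow : ℕ → Fin n → Set
  OnRow i v = proj₂ (decode v) ≡ m * i

  InStrip : ℕ → Fin n → Set
  InStrip J v = (a + m * (J + J) ≤ proj₁ (decode v)) × (proj₁ (decode v) ≤ a + m * suc (J + J))

  onRow-unique : ∀ i i′ v → OnRow i v → OnRow i′ v → i ≡ i′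
  onRow-unique i i′ v r r′ = *-cancelˡ-≡ i i′ m (trans (sym r) r′)

  strip-end<next-strip : ∀ J J′ → J < J′ → a + m * suc (J + J) < a + m * (J′ + J′)
  strip-end<next-strip J (suc J′) (s≤s J≤J′) =
    +-monoʳ-< a (*-monoʳ-< m (s≤s (subst (J + J <_) (sym (+-suc J′ J′)) (s≤s (+-mono-≤ J≤J′ J≤J′)))))

  inStrip-unique : ∀ J J′ v → InStrip J v → InStrip J′ v → J ≡ J′
  inStrip-unique J J′ v (l , u) (l′ , u′) with <-cmp J J′
  ... | tri≈ _ e _ = e
  ... | tri< lt _ _ = ⊥-elim (<-irrefl refl (<-≤-trans (≤-<-trans u (strip-end<next-strip J J′ lt)) l′))
  ... | tri> _ _ gt = ⊥-elim (<-irrefl refl (<-≤-trans (≤-<-trans u′ (strip-end<next-strip J′ J gt)) l))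

  module Avoiding (X : Subset n) (i : ℕ) (i<R : i < R) (row-free : ∀ v → v ∈ X → ¬ OnRow i v)
    (J : ℕ) (J≤N : J < suc N) (strip-free : ∀ v → v ∈ X → ¬ InStrip J v) where

    J+J<C' : J + J < C'
    J+J<C' = s≤s (≤-trans (+-mono-≤ (≤-pred J≤N) (≤-pred J≤N)) (n≤1+n (N + N)))

    open Detour i J i<R J+J<C'

    1≤L : 1 ≤ Walk.L detourWalk
    1≤L = ≤-trans 1≤a (≤-trans (m≤m+n a (m * J₂)) (m≤m+n x₀ _))

    P : Path grid
    P = walkPath detourWalk 1≤L

    detour-aPath : IsAPath terminals P
    detour-aPath = record
      { nonTrivial = 1≤L
      ; startIn = ∈-terminals⁺ (vert P zero) (subst Terminal (sym (decode-walkVertex detourWalk 1≤L zero)) (inj₁ (i , i<R , detour-start)))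
      ; endIn = ∈-terminals⁺ (vert P (fromℕ (Walk.L detourWalk))) (subst Terminal (sym (decode-walkVertex detourWalk 1≤L (fromℕ (Walk.L detourWalk))))
                  (inj₂ (i , i<R , subst (λ z → Walk.pt detourWalk z ≡ (W , m * i)) (sym (toℕ-fromℕ (Walk.L detourWalk))) detour-end)))
      ; interior = λ k k≢0 k≢L k∈A → interior-not-terminal detourWalk (toℕ k) (positive k k≢0) (below-last k k≢L)
                     (subst Terminal (decode-walkVertex detourWalk 1≤L k) (∈-terminals⁻ (vert P k) k∈A))
      }
      where
      positive : ∀ k → k ≢ zero → 0 < toℕ k
      positive zero k≢0 = ⊥-elim (k≢0 refl)
      positive (suc k) _ = s≤s z≤n
      below-last : ∀ k → k ≢ fromℕ (Walk.L detourWalk) → toℕ k < Walk.L detourWalk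
      below-last k k≢L with m≤n⇒m<n∨m≡n (≤-pred (toℕ<n k))
      ... | inj₁ lt = lt
      ... | inj₂ e = ⊥-elim (k≢L (toℕ-injective (trans e (sym (toℕ-fromℕ (Walk.L detourWalk))))))

    detour-modAPath : ModAPath grid terminals m d P
    detour-modAPath = detour-aPath , mod⇒%≡ m (Walk.L detourWalk) d (detour-length≡d d a+b≡d+h0)

    detour-missed : ¬ Meets X P
    detour-missed (k , k∈X) = missed (detour-inside (toℕ k) (≤-pred (toℕ<n k)))
      where
      missed : InRowOrStrip (Walk.pt detourWalk (toℕ k)) → ⊥
      missed (inj₁ on-row) = row-free (vert P k) k∈X (trans (cong proj₂ (decode-walkVertex detourWalk 1≤L k)) on-row)
      missed (inj₂ in-strip) = strip-free (vert P k) k∈X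
        (subst (λ z → (a + m * (J + J) ≤ proj₁ z) × (proj₁ z ≤ a + m * suc (J + J))) (sym (decode-walkVertex detourWalk 1≤L k)) in-strip)

  no-EP-function : (f : ℕ → ℕ) → f 2 ≡ N → ¬ EPFunction m d f
  no-EP-function f f2≡N ep with ep 2 (s≤s z≤n) n grid terminals
  ... | inj₁ (Ps , modAPaths , disjoint) =
    no-two-disjoint-modAPaths (Ps zero) (Ps (suc zero)) (modAPaths zero) (modAPaths (suc zero)) (disjoint zero (suc zero) (λ ()))
  ... | inj₂ (X , ∣X∣≤ , hits)
    with avoided-class OnRow (λ i v → proj₂ (decode v) ≟ m * i) onRow-unique R X (s≤s (subst (∣ X ∣ ≤_) f2≡N ∣X∣≤))
       | avoided-class InStrip (λ J v → (a + m * (J + J) ≤? proj₁ (decode v)) ×-dec (proj₁ (decode v) ≤? a + m * suc (J + J)))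
           inStrip-unique (suc N) X (s≤s (subst (∣ X ∣ ≤_) f2≡N ∣X∣≤))
  ...   | i , i<R , row-free | J , J≤N , strip-free = detour-missed (hits P detour-modAPath)
    where open Avoiding X i i<R row-free J J≤N strip-free

-- A composite m > 4 has a divisor 3 ≤ h0 < m (if 2 is its only small
-- divisor, take m / 2 > 2).  The offset a ∈ {1, 2} makes 2a ≢ d mod h0, and
-- b ≥ 1 is chosen with a + b ≡ d + h0 mod m; then 2b ≡ 2d − 2a mod h0, so
-- 2b ≢ d as well.
module Parameters where

  open import Data.Nat
  open import Data.Nat.Properties
  open import Data.Nat.DivMod using (m%n%n≡m%n; m<n⇒m%n≡m)
  open import Data.Nat.Divisibility using (divides)
  open import Data.Nat.Primality using (Composite)
  open import Data.Nat.Divisibility.Core using (hasNonTrivialDivisor)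
  open import Data.Empty using (⊥-elim)
  open import Relation.Nullary using (¬_; yes; no)
  open import Relation.Binary.PropositionalEquality
  open import Data.Integer using () renaming (+_ to ι; _+_ to _+ℤ_; -_ to -ℤ_)
  open import Data.Integer.Properties using (pos-+; pos-*)
  open import Data.Integer.Tactic.RingSolver using (solve-∀)
  open import Data.Nat.Tactic.RingSolver renaming (solve-∀ to ℕ-solve-∀)
  open Congruence

  record LargeDivisor (m : ℕ) : Set where
    field
      h0 r   : ℕ
      3≤h0   : 3 ≤ h0
      h0<m   : h0 < m
      m≡r*h0 : m ≡ r * h0

  largeDivisor : ∀ m → 4 < m → Composite m → LargeDivisor m
  largeDivisor m 4<m (hasNonTrivialDivisor {δ} {{nontrivial}} δ<m (divides q m≡qδ)) with 3 ≤? δ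
  ... | yes 3≤δ = record { h0 = δ ; r = q ; 3≤h0 = 3≤δ ; h0<m = δ<m ; m≡r*h0 = m≡qδ }
  ... | no 3≰δ = record { h0 = q ; r = δ ; 3≤h0 = 3≤q ; h0<m = q<m ; m≡r*h0 = trans m≡qδ (*-comm q δ) }
    where
    δ≡2 : δ ≡ 2
    δ≡2 = ≤-antisym (≤-pred (≰⇒> 3≰δ)) (nonTrivial⇒n>1 δ {{nontrivial}})
    m≡q+q : m ≡ q + q
    m≡q+q = trans m≡qδ (trans (cong (q *_) δ≡2) (trans (*-comm q 2) (cong (q +_) (+-identityʳ q))))
    3≤q : 3 ≤ q
    3≤q with 3 ≤? q
    ... | yes 3≤q = 3≤q
    ... | no 3≰q = ⊥-elim (<-irrefl refl (≤-<-trans (subst (_≤ 4) (sym m≡q+q) (+-mono-≤ q≤2 q≤2)) 4<m))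
      where
      q≤2 : q ≤ 2
      q≤2 = ≤-pred (≰⇒> 3≰q)
    q<m : q < m
    q<m = subst (q <_) (sym m≡q+q) (m<m+n q (≤-trans (s≤s z≤n) 3≤q))

  module Offsets (m d : ℕ) (D : LargeDivisor m) where
    open LargeDivisor D

    instance
      h0≢0 : NonZero h0
      h0≢0 = >-nonZero (≤-trans (s≤s z≤n) 3≤h0)
      m≢0 : NonZero m
      m≢0 = >-nonZero (<-trans (≤-trans (s≤s z≤n) 3≤h0) h0<m)

    a : ℕ
    a with 2 % h0 ≟ d % h0
    ... | yes _ = 2
    ... | no _ = 1

    1≤a : 1 ≤ a
    1≤a with 2 % h0 ≟ d % h0
    ... | yes _ = s≤s z≤n
    ... | no _ = s≤s z≤n

    a≤m : a ≤ m
    a≤m with 2 % h0 ≟ d % h0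
    ... | yes _ = ≤-trans (s≤s (s≤s z≤n)) (<⇒≤ (≤-<-trans 3≤h0 h0<m))
    ... | no _ = ≤-trans (s≤s z≤n) (<⇒≤ (≤-<-trans 3≤h0 h0<m))

    d≢2a : ¬ (ι d ≡ ι (a + a) mod h0)
    d≢2a d≡2a with 2 % h0 ≟ d % h0 | mod⇒%≡ h0 d _ d≡2a
    ... | no 2≢d | d≡2 = 2≢d (sym d≡2)
    ... | yes 2≡d | d≡4 = 2≢0 (trans (sym (m<n⇒m%n≡m 3≤h0)) (trans (mod⇒%≡ h0 2 0 2≡0) (m<n⇒m%n≡m (≤-trans (s≤s z≤n) 3≤h0))))
      where
      2≢0 : 2 ≢ 0
      2≢0 ()
      2≡0 : ι 2 ≡ ι 0 mod h0
      2≡0 = mod-sym (mod-+ (%≡⇒mod h0 2 4 (trans 2≡d d≡4)) (mod-refl {u = -ℤ ι 2}))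

    s : ℕ
    s = d + h0 + (m ∸ a)

    b : ℕ
    b = m + s % m

    1≤b : 1 ≤ b
    1≤b = ≤-trans (>-nonZero⁻¹ m) (m≤m+n m _)

    a+b≡d+h0 : ι (a + b) ≡ ι (d + h0) mod m
    a+b≡d+h0 = mod-trans a+b≡a+m+s (ι 2 , a+m+s≡d+h0+2m)
      where
      a+b≡a+m+s : ι (a + b) ≡ ι (a + m) +ℤ ι s mod m
      a+b≡a+m+s = mod-trans (mod-reflexive (trans (cong ι (sym (+-assoc a m (s % m)))) (pos-+ (a + m) (s % m))))
                    (mod-+ (mod-refl {u = ι (a + m)}) (%≡⇒mod m (s % m) s (m%n%n≡m%n s m)))
      identity₁ : ∀ a m e t → a + m + (e + t) ≡ e + (a + t) + m
      identity₁ = ℕ-solve-∀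
      identity₂ : ∀ e m → e + m + m ≡ e + 2 * m
      identity₂ = ℕ-solve-∀
      a+m+s≡ : a + m + s ≡ (d + h0) + 2 * m
      a+m+s≡ = trans (identity₁ a m (d + h0) (m ∸ a))
                 (trans (cong (λ z → (d + h0) + z + m) (m+[n∸m]≡n a≤m)) (identity₂ (d + h0) m))
      a+m+s≡d+h0+2m : ι (a + m) +ℤ ι s ≡ ι (d + h0) +ℤ ι 2 Data.Integer.* ι m
      a+m+s≡d+h0+2m = trans (sym (pos-+ (a + m) s)) (trans (cong ι a+m+s≡)
                        (trans (pos-+ (d + h0) (2 * m)) (cong (ι (d + h0) +ℤ_) (pos-* 2 m))))

    d≢2b : ¬ (ι d ≡ ι (b + b) mod h0)
    d≢2b d≡2b = d≢2a (mod-sym 2a≡d)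
      where
      a+b≡d : ι a +ℤ ι b ≡ ι d mod h0
      a+b≡d = mod-trans (mod-reflexive (sym (pos-+ a b))) (mod-trans (mod-divisor {r = r} {h0} m≡r*h0 a+b≡d+h0)
                (ι 1 , trans (pos-+ d h0) (cong (ι d +ℤ_) (sym (Data.Integer.Properties.*-identityˡ (ι h0))))))
      -2b≡-d : -ℤ (ι b +ℤ ι b) ≡ -ℤ ι d mod h0
      -2b≡-d = mod-neg (mod-trans (mod-reflexive (sym (pos-+ b b))) (mod-sym d≡2b))
      identity₁ : ∀ A B → A +ℤ A ≡ ((A +ℤ B) +ℤ (A +ℤ B)) +ℤ (-ℤ (B +ℤ B))
      identity₁ = solve-∀
      identity₂ : ∀ D → (D +ℤ D) +ℤ (-ℤ D) ≡ D
      identity₂ = solve-∀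
      2a≡d : ι (a + a) ≡ ι d mod h0
      2a≡d = mod-trans (mod-reflexive (trans (pos-+ a a) (identity₁ (ι a) (ι b))))
               (mod-trans (mod-+ (mod-+ a+b≡d a+b≡d) -2b≡-d) (mod-reflexive (identity₂ (ι d))))

open import Data.Nat using (s≤s; z≤n)
open import Data.Nat.Properties using (≤-trans)
open import Data.Product using (_,_)
open import Relation.Binary.PropositionalEquality using (refl)

proposition8 : ∀ (m : ℕ) .{{_ : NonZero m}} → 4 < m → Composite m → ∀ (d : ℕ) → d < m → ¬ (Σ (ℕ → ℕ) λ f → EPFunction m d f)
proposition8 m 4<m composite d _ (f , ep) =
  Counterexample.no-EP-function m h0 a b d r (f 2) h0<m (≤-trans (s≤s z≤n) 3≤h0) 1≤a 1≤b a+b≡d+h0 d≢2a d≢2b m≡r*h0 f refl ep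
  where
  open Parameters
  D : LargeDivisor m
  D = largeDivisor m 4<m composite
  open LargeDivisor D
  open Offsets m d D
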